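{- Let $G$ be an $\mathrm{AND}_\ell$-gadget ($\ell\ge1$) with in-terminals $B=\{b_0,\ldots,b_{2^\ell-1}\}$ and out-terminals $a_0,a_1$. Let $\psi$ be a partition of $B$ into binary blocks, and let $\rho$ be the coarsest stable partition of $V(G)$ that refines $\psi$. Then $\rho$ agrees with $\psi$. Furthermore, $\rho$ distinguishes $a_0$ from $a_1$ if and only if $\psi$ distinguishes all in-terminal pairs.
   Context: Gadgets: $\mathrm{AND}_1$ has vertices $a_0,a_1,b_0,b_1$ and edges $a_0b_0,a_1b_1$. $\mathrm{AND}_2$ has vertices $a_0,a_1,b_0,b_1,b_2,b_3,c_0,c_1,c_2,c_3$ and edges $a_0c_0,a_0c_1,a_1c_2,a_1c_3,b_0c_0,b_0c_2,b_1c_1,b_1c_3,b_2c_1,b_2c_2,b_3c_0,b_3c_3$. For $\ell\ge3$, $\mathrm{AND}_\ell$ is obtained from a copy $G^*$ of $\mathrm{AND}_2$ and two copies $G',G''$ of $\mathrm{AND}_{\ell-1}$ by adding edges joining the out-terminals $a_0,a_1$ of $G'$ to the in-terminals $b_0,b_1$ of $G^*$ respectively, and the out-terminals $a_0,a_1$ of $G''$ to the in-terminals $b_2,b_3$ of $G^*$ respectively; its out-terminals are those of $G^*$ and its in-terminal sequence is that of $G'$ followed by that of $G''$. In all cases the out-terminals are $a_0,a_1$ and the in-terminals $b_0,\ldots,b_{2^\ell-1}$. A binary block of $B$ is a set $\{b_i: q2^{\ell-j}\le i\le (q+1)2^{\ell-j}-1\}$ for some $j\in\{0,\ldots,\ell\}$,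 $q\in\{0,\ldots,2^j-1\}$; a partition into binary blocks is one all of whose cells are binary blocks. The in-terminal pairs are $\{b_{2p},b_{2p+1}\}$ for $p\in\{0,\ldots,2^{\ell-1}-1\}$. A partition $\pi$ of $V(G)$ is stable if for all $u,v$ in a common cell and every cell $R$, $|N(u)\cap R|=|N(v)\cap R|$. For a partition $\psi$ of a subset $B\subseteq V(G)$, a partition $\rho$ of $V(G)$ refines $\psi$ if it refines $\psi\cup\{V(G)\setminus B\}$ (every cell of $\rho$ lies in a cell of that partition), and agrees with $\psi$ if $\rho[B]=\psi$ (the partition induced on $B$). A partition distinguishes $x$ from $y$ if $x,y$ lie in different cells; $\psi$ distinguishes a pair if it distinguishes its two elements. -}

module Defs where

open import Data.Nat using (ℕ; zero; suc; _+_; _*_; _^_; _≤_; _<_; _≡ᵇ_)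
open import Data.Nat.Properties using (+-identityʳ)
open import Data.Bool using (Bool; true; false; _∧_; _∨_; if_then_else_)
open import Data.Fin using (Fin; toℕ; splitAt; cast)
import Data.Fin as F
open import Data.Sum using (_⊎_; inj₁; inj₂)
open import Data.Product using (Σ; ∃; _×_; _,_)
open import Data.List using (List; []; _∷_; _++_; map)
open import Data.Nat.ListAction using (sum)
open import Relation.Binary.PropositionalEquality using (_≡_; _≢_)
open import Relation.Nullary using (¬_)
open import Function using (_∘_; _⇔_)

-- The gadgets.  The gadget AND_ℓ is indexed by n with ℓ = suc n (so ℓ ≥ 1).

data V1 : Set where
  a0 a1 b0 b1 : V1

data V2 : Set where
  a0 a1 b0 b1 b2 b3 c0 c1 c2 c3 : V2

-- vertex set of AND_(suc n); for ℓ ≥ 3: G* ⊎ (G' ⊎ G'')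
V : ℕ → Set
V zero = V1
V (suc zero) = V2
V (suc (suc n)) = V2 ⊎ (V (suc n) ⊎ V (suc n))

E1 : V1 → V1 → Bool
E1 a0 b0 = true
E1 a1 b1 = true
E1 _ _ = false

E2 : V2 → V2 → Bool
E2 a0 c0 = true
E2 a0 c1 = true
E2 a1 c2 = true
E2 a1 c3 = true
E2 b0 c0 = true
E2 b0 c2 = true
E2 b1 c1 = true
E2 b1 c3 = true
E2 b2 c1 = true
E2 b2 c2 = true
E2 b3 c0 = true
E2 b3 c3 = true
E2 _ _ = false

adj1 : V1 → V1 → Bool
adj1 x y = E1 x y ∨ E1 y x

adj2 : V2 → V2 → Bool
adj2 x y = E2 x y ∨ E2 y x

out : (n : ℕ) → Fin 2 → V n
out zero F.zero = a0
out zero (F.suc _) = a1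
out (suc zero) F.zero = a0
out (suc zero) (F.suc _) = a1
out (suc (suc n)) F.zero = inj₁ a0
out (suc (suc n)) (F.suc _) = inj₁ a1

isA0 : (n : ℕ) → V n → Bool
isA0 zero a0 = true
isA0 zero _ = false
isA0 (suc zero) a0 = true
isA0 (suc zero) _ = false
isA0 (suc (suc n)) (inj₁ a0) = true
isA0 (suc (suc n)) _ = false

isA1 : (n : ℕ) → V n → Bool
isA1 zero a1 = true
isA1 zero _ = false
isA1 (suc zero) a1 = true
isA1 (suc zero) _ = false
isA1 (suc (suc n)) (inj₁ a1) = true
isA1 (suc (suc n)) _ = false

-- connecting edges: out-terminals of G' to b₀,b₁ of G*, of G'' to b₂,b₃ of G*
crossL : (n : ℕ) → V n → V2 → Bool
crossL n x b0 = isA0 n x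
crossL n x b1 = isA1 n x
crossL n x _ = false

crossR : (n : ℕ) → V n → V2 → Bool
crossR n x b2 = isA0 n x
crossR n x b3 = isA1 n x
crossR n x _ = false

adj : (n : ℕ) → V n → V n → Bool
adj zero x y = adj1 x y
adj (suc zero) x y = adj2 x y
adj (suc (suc n)) (inj₁ x) (inj₁ y) = adj2 x y
adj (suc (suc n)) (inj₁ x) (inj₂ (inj₁ y)) = crossL (suc n) y x
adj (suc (suc n)) (inj₁ x) (inj₂ (inj₂ y)) = crossR (suc n) y x
adj (suc (suc n)) (inj₂ (inj₁ x)) (inj₁ y) = crossL (suc n) x y
adj (suc (suc n)) (inj₂ (inj₂ x)) (inj₁ y) = crossR (suc n) x y
adj (suc (suc n)) (inj₂ (inj₁ x)) (inj₂ (inj₁ y)) = adj (suc n) x y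
adj (suc (suc n)) (inj₂ (inj₂ x)) (inj₂ (inj₂ y)) = adj (suc n) x y
adj (suc (suc n)) (inj₂ (inj₁ x)) (inj₂ (inj₂ y)) = false
adj (suc (suc n)) (inj₂ (inj₂ x)) (inj₂ (inj₁ y)) = false

-- in-terminals b_0 … b_{2^ℓ - 1}: those of G' followed by those of G''
selIn : (n : ℕ) → (Fin (2 ^ suc (suc n)) → V (suc n)) →
        Fin (2 ^ suc (suc n)) ⊎ Fin (2 ^ suc (suc n) + 0) → V (suc (suc n))
selIn n f (inj₁ j) = inj₂ (inj₁ (f j))
selIn n f (inj₂ k) = inj₂ (inj₂ (f (cast (+-identityʳ (2 ^ suc (suc n))) k)))

inT2 : Fin 4 → V2
inT2 F.zero = b0
inT2 (F.suc F.zero) = b1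
inT2 (F.suc (F.suc F.zero)) = b2
inT2 (F.suc (F.suc (F.suc _))) = b3

inTs : (m : ℕ) → Fin (2 ^ suc (suc m)) → V (suc m)
inTs zero = inT2
inTs (suc m) i = selIn m (inTs m) (splitAt (2 ^ suc (suc m)) i)

inT : (n : ℕ) → Fin (2 ^ suc n) → V n
inT zero F.zero = b0
inT zero (F.suc _) = b1
inT (suc m) = inTs m

verts1 : List V1
verts1 = a0 ∷ a1 ∷ b0 ∷ b1 ∷ []

verts2 : List V2
verts2 = a0 ∷ a1 ∷ b0 ∷ b1 ∷ b2 ∷ b3 ∷ c0 ∷ c1 ∷ c2 ∷ c3 ∷ []

verts : (n : ℕ) → List (V n)
verts zero = verts1
verts (suc zero) = verts2
verts (suc (suc n)) =
  map inj₁ verts2 ++ map (inj₂ ∘ inj₁) (verts (suc n)) ++ map (inj₂ ∘ inj₂) (verts (suc n))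

-- Partitions are represented by colourings (cells = colour classes).

nbCount : (n : ℕ) → (V n → ℕ) → V n → ℕ → ℕ
nbCount n ρ u c = sum (map (λ w → if adj n u w ∧ (ρ w ≡ᵇ c) then 1 else 0) (verts n))

Stable : (n : ℕ) → (V n → ℕ) → Set
Stable n ρ = ∀ u v → ρ u ≡ ρ v → ∀ c → nbCount n ρ u c ≡ nbCount n ρ v c

BinaryBlockPartition : (n : ℕ) → (Fin (2 ^ suc n) → ℕ) → Set
BinaryBlockPartition n ψ =
  ∀ i → Σ ℕ λ j → Σ ℕ λ q → j ≤ suc n × q < 2 ^ j ×
    (∀ k → (ψ k ≡ ψ i) ⇔
       (q * 2 ^ (suc n Data.Nat.∸ j) ≤ toℕ k × toℕ k < suc q * 2 ^ (suc n Data.Nat.∸ j)))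

InB : (n : ℕ) → V n → Set
InB n v = ∃ λ i → inT n i ≡ v

-- u, v lie in a common cell of ψ ∪ {V(G) ∖ B}
SameExt : (n : ℕ) → (Fin (2 ^ suc n) → ℕ) → V n → V n → Set
SameExt n ψ u v =
  (∃ λ i → ∃ λ j → inT n i ≡ u × inT n j ≡ v × ψ i ≡ ψ j) ⊎ (¬ InB n u × ¬ InB n v)

RefinesB : (n : ℕ) → (V n → ℕ) → (Fin (2 ^ suc n) → ℕ) → Set
RefinesB n ρ ψ = ∀ u v → ρ u ≡ ρ v → SameExt n ψ u v

Refines : (n : ℕ) → (V n → ℕ) → (V n → ℕ) → Set
Refines n ρ' ρ = ∀ u v → ρ' u ≡ ρ' v → ρ u ≡ ρ v

CoarsestStableRefining : (n : ℕ) → (Fin (2 ^ suc n) → ℕ) → (V n → ℕ) → Set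
CoarsestStableRefining n ψ ρ =
  Stable n ρ × RefinesB n ρ ψ × (∀ ρ' → Stable n ρ' → RefinesB n ρ' ψ → Refines n ρ' ρ)

Agrees : (n : ℕ) → (V n → ℕ) → (Fin (2 ^ suc n) → ℕ) → Set
Agrees n ρ ψ = ∀ i j → (ρ (inT n i) ≡ ρ (inT n j)) ⇔ (ψ i ≡ ψ j)

DistinguishesAllPairs : (n : ℕ) → (Fin (2 ^ suc n) → ℕ) → Set
DistinguishesAllPairs n ψ =
  ∀ (p : ℕ) (i j : Fin (2 ^ suc n)) → toℕ i ≡ p + p → toℕ j ≡ suc (p + p) → ψ i ≢ ψ j

module Submission where

open import Defs
open import Data.Nat using (ℕ; zero; suc; _+_; _*_; _^_; _≤_; _<_; _≡ᵇ_; z≤n; s≤s; _∸_; _⊓_)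
open import Data.Nat.Properties
open import Data.Bool using (Bool; true; false; _∧_; if_then_else_)
import Data.Bool.Properties as Bool
open import Data.Fin using (Fin; toℕ; splitAt; cast; _↑ˡ_; _↑ʳ_; join)
import Data.Fin as F
import Data.Fin.Properties as Fin
open import Data.Sum using (_⊎_; inj₁; inj₂)
import Data.Sum as Sum
open import Data.Sum.Properties using (inj₁-injective; inj₂-injective)
open import Data.Product using (∃; _×_; _,_; proj₁; proj₂)
open import Data.List using (List; []; _∷_; _++_; map; downFrom)
open import Data.List.Properties using (map-++; map-∘)
open import Data.Nat.ListAction using (sum)
open import Data.Nat.ListAction.Properties using (sum-++)
open import Data.List.Membership.Propositional using (_∈_)
open import Data.List.Membership.Propositional.Properties using (∈-map⁺; ∈-++⁺ˡ; ∈-++⁺ʳ)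
open import Data.List.Relation.Unary.Any using (here; there)
import Data.List.Relation.Unary.All as All
open import Relation.Binary.PropositionalEquality
open import Relation.Nullary using (¬_; yes; no; Dec)
open import Relation.Nullary.Decidable using (map′; _×-dec_; _⊎-dec_; _→-dec_; from-yes; True; toWitness)
open import Data.Empty using (⊥; ⊥-elim)
open import Function using (_∘_; _⇔_; id)
open import Function.Bundles using (mk⇔; Equivalence)
open import Data.Nat.Solver using (module +-*-Solver)
open +-*-Solver using (solve; _:+_; _:*_; _:=_; con)

-- Invariance: ρ is invariant under every involutive automorphism σ of the gadget that
-- preserves ψ, because min(ρ, ρ ∘ σ) is again stable and refines ψ (`invariance`; its
-- counting core is `coarsening-counts`).  The automorphisms are assembled recursively from
-- automorphisms of AND₂ (`lift`, `swapHalves`).  With them every binary block on which ψ is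
-- constant collapses under ρ, so ρ agrees with ψ (`agrees`); and for every in-terminal pair
-- the automorphism flipping the path from the pair to the output exchanges a₀ and a₁
-- (`pair-flip`), so a pair merged by ψ merges a₀ with a₁ (`merge-outputs`).
-- Conversely, if ψ distinguishes all pairs it is injective (`ψ-injective`), and every vertex
-- of positive rank is the only vertex adjacent to two given vertices of lower rank
-- (`pinned`); by induction on the rank ρ is discrete, so it separates a₀ from a₁
-- (`separate-outputs`).

private
  variable
    A B : Set

sum-cong : (xs : List A) {f g : A → ℕ} → (∀ x → f x ≡ g x) → sum (map f xs) ≡ sum (map g xs)
sum-cong [] e = refl
sum-cong (x ∷ xs) e = cong₂ _+_ (e x) (sum-cong xs e)

sum-+ : (xs : List A) (f g : A → ℕ) →
  sum (map (λ x → f x + g x) xs) ≡ sum (map f xs) + sum (map g xs)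
sum-+ [] f g = refl
sum-+ (x ∷ xs) f g = begin
  f x + g x + sum (map (λ x → f x + g x) xs)      ≡⟨ cong (f x + g x +_) (sum-+ xs f g) ⟩
  f x + g x + (sum (map f xs) + sum (map g xs))   ≡⟨ solve 4 (λ a b c d → a :+ b :+ (c :+ d) := a :+ c :+ (b :+ d))
                                                       refl (f x) (g x) (sum (map f xs)) (sum (map g xs)) ⟩
  f x + sum (map f xs) + (g x + sum (map g xs))   ∎
  where open ≡-Reasoning

sum-map-++ : (xs ys : List A) (f : A → ℕ) → sum (map f (xs ++ ys)) ≡ sum (map f xs) + sum (map f ys)
sum-map-++ xs ys f = trans (cong sum (map-++ f xs ys)) (sum-++ (map f xs) (map f ys))

sum-map-∘ : (xs : List A) (f : B → ℕ) (h : A → B) → sum (map f (map h xs)) ≡ sum (map (f ∘ h) xs)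
sum-map-∘ xs f h = cong sum (sym (map-∘ xs))

sum-*ˡ : (xs : List A) (k : ℕ) (f : A → ℕ) → sum (map (λ x → k * f x) xs) ≡ k * sum (map f xs)
sum-*ˡ [] k f = sym (*-zeroʳ k)
sum-*ˡ (x ∷ xs) k f = trans (cong (k * f x +_) (sum-*ˡ xs k f)) (sym (*-distribˡ-+ k (f x) _))

term≤sum : (xs : List A) (f : A → ℕ) {x : A} → x ∈ xs → f x ≤ sum (map f xs)
term≤sum (y ∷ xs) f (here refl) = m≤m+n (f y) _
term≤sum (y ∷ xs) f (there m) = ≤-trans (term≤sum xs f m) (m≤n+m _ (f y))

positive-term : (xs : List A) (f : A → ℕ) → 1 ≤ sum (map f xs) → ∃ λ x → 1 ≤ f x
positive-term [] f ()
positive-term (y ∷ xs) f le with f y in eq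
... | zero = positive-term xs f le
... | suc k = y , subst (1 ≤_) (sym eq) (s≤s z≤n)

sum-scale : (xs : List A) (P h : A → ℕ) (H : ℕ) → (∀ x → P x ≡ 0 ⊎ h x ≡ H) →
  sum (map (λ x → P x * h x) xs) ≡ H * sum (map P xs)
sum-scale [] P h H e = sym (*-zeroʳ H)
sum-scale (x ∷ xs) P h H e =
  trans (cong₂ _+_ (term (e x)) (sum-scale xs P h H e)) (sym (*-distribˡ-+ H (P x) _))
  where
  term : P x ≡ 0 ⊎ h x ≡ H → P x * h x ≡ H * P x
  term (inj₁ p) rewrite p = sym (*-zeroʳ H)
  term (inj₂ q) rewrite q = *-comm (P x) H

sum-weighted-zero : (xs : List A) (P h : A → ℕ) → sum (map P xs) ≡ 0 → sum (map (λ x → P x * h x) xs) ≡ 0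
sum-weighted-zero [] P h e = refl
sum-weighted-zero (x ∷ xs) P h e
  rewrite m+n≡0⇒m≡0 (P x) e = sum-weighted-zero xs P h (m+n≡0⇒n≡0 (P x) e)

sum-swap : (xs : List A) (ds : List ℕ) (G : A → ℕ → ℕ) →
  sum (map (λ w → sum (map (G w) ds)) xs) ≡ sum (map (λ d → sum (map (λ w → G w d) xs)) ds)
sum-swap [] ds G = sym (zeros ds)
  where
  zeros : (ds : List ℕ) → sum (map (λ _ → 0) ds) ≡ 0
  zeros [] = refl
  zeros (_ ∷ ds) = zeros ds
sum-swap (x ∷ xs) ds G = trans (cong (sum (map (G x) ds) +_) (sum-swap xs ds G))
  (sym (sum-+ ds (G x) (λ d → sum (map (λ w → G w d) xs))))

verts-complete : (n : ℕ) (x : V n) → x ∈ verts n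
verts-complete zero a0 = here refl
verts-complete zero a1 = there (here refl)
verts-complete zero b0 = there (there (here refl))
verts-complete zero b1 = there (there (there (here refl)))
verts-complete (suc zero) a0 = here refl
verts-complete (suc zero) a1 = there (here refl)
verts-complete (suc zero) b0 = there (there (here refl))
verts-complete (suc zero) b1 = there (there (there (here refl)))
verts-complete (suc zero) b2 = there (there (there (there (here refl))))
verts-complete (suc zero) b3 = there (there (there (there (there (here refl)))))
verts-complete (suc zero) c0 = there (there (there (there (there (there (here refl))))))
verts-complete (suc zero) c1 = there (there (there (there (there (there (there (here refl)))))))
verts-complete (suc zero) c2 = there (there (there (there (there (there (there (there (here refl))))))))
verts-complete (suc zero) c3 = there (there (there (there (there (there (there (there (there (here refl)))))))))
verts-complete (suc (suc n)) (inj₁ x) = ∈-++⁺ˡ (∈-map⁺ inj₁ (verts-complete (suc zero) x))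
verts-complete (suc (suc n)) (inj₂ (inj₁ x)) =
  ∈-++⁺ʳ (map inj₁ verts2) (∈-++⁺ˡ (∈-map⁺ (inj₂ ∘ inj₁) (verts-complete (suc n) x)))
verts-complete (suc (suc n)) (inj₂ (inj₂ x)) =
  ∈-++⁺ʳ (map inj₁ verts2) (∈-++⁺ʳ (map (inj₂ ∘ inj₁) (verts (suc n))) (∈-map⁺ (inj₂ ∘ inj₂) (verts-complete (suc n) x)))

SV : (n : ℕ) → (V n → ℕ) → ℕ
SV n g = sum (map g (verts n))

SV-cong : (n : ℕ) {f g : V n → ℕ} → (∀ x → f x ≡ g x) → SV n f ≡ SV n g
SV-cong n = sum-cong (verts n)

SV-split : (m : ℕ) (g : V (suc (suc m)) → ℕ) →
  SV (suc (suc m)) g ≡ SV 1 (g ∘ inj₁) + (SV (suc m) (g ∘ inj₂ ∘ inj₁) + SV (suc m) (g ∘ inj₂ ∘ inj₂))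
SV-split m g = begin
  SV (suc (suc m)) g
    ≡⟨ sum-map-++ (map inj₁ verts2) (map (inj₂ ∘ inj₁) (verts (suc m)) ++ map (inj₂ ∘ inj₂) (verts (suc m))) g ⟩
  sum (map g (map inj₁ verts2)) + sum (map g (map (inj₂ ∘ inj₁) (verts (suc m)) ++ map (inj₂ ∘ inj₂) (verts (suc m))))
    ≡⟨ cong₂ _+_ (sum-map-∘ verts2 g inj₁) (sum-map-++ (map (inj₂ ∘ inj₁) (verts (suc m))) (map (inj₂ ∘ inj₂) (verts (suc m))) g) ⟩
  SV 1 (g ∘ inj₁) + (sum (map g (map (inj₂ ∘ inj₁) (verts (suc m)))) + sum (map g (map (inj₂ ∘ inj₂) (verts (suc m)))))
    ≡⟨ cong (SV 1 (g ∘ inj₁) +_) (cong₂ _+_ (sum-map-∘ (verts (suc m)) g (inj₂ ∘ inj₁)) (sum-map-∘ (verts (suc m)) g (inj₂ ∘ inj₂))) ⟩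
  SV 1 (g ∘ inj₁) + (SV (suc m) (g ∘ inj₂ ∘ inj₁) + SV (suc m) (g ∘ inj₂ ∘ inj₂)) ∎
  where open ≡-Reasoning

≡ᵇ-refl : ∀ m → (m ≡ᵇ m) ≡ true
≡ᵇ-refl m = Equivalence.to Bool.T-≡ (≡⇒≡ᵇ m m refl)

≡ᵇ-sound : ∀ m n → (m ≡ᵇ n) ≡ true → m ≡ n
≡ᵇ-sound m n e = ≡ᵇ⇒≡ m n (Equivalence.from Bool.T-≡ e)

≢⇒≡ᵇ-false : ∀ m n → ¬ m ≡ n → (m ≡ᵇ n) ≡ false
≢⇒≡ᵇ-false m n ne with m ≡ᵇ n in eq
... | false = refl
... | true = ⊥-elim (ne (≡ᵇ-sound m n eq))

indicator : Bool → ℕ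
indicator true = 1
indicator false = 0

nbCount-indicator : ∀ n (τ : V n → ℕ) u c →
  nbCount n τ u c ≡ SV n (λ w → indicator (adj n u w) * indicator (τ w ≡ᵇ c))
nbCount-indicator n τ u c = SV-cong n (λ w → product (adj n u w) (τ w ≡ᵇ c))
  where
  product : ∀ a b → (if a ∧ b then 1 else 0) ≡ indicator a * indicator b
  product true true = refl
  product true false = refl
  product false b = refl

nbOfColour : ∀ n (ρ : V n → ℕ) → V n → ℕ → V n → ℕ
nbOfColour n ρ u d w = if adj n u w ∧ (ρ w ≡ᵇ d) then 1 else 0

count-positive : ∀ n (ρ : V n → ℕ) u w → adj n u w ≡ true → 1 ≤ nbCount n ρ u (ρ w)
count-positive n ρ u w e = ≤-trans positive (term≤sum (verts n) (nbOfColour n ρ u (ρ w)) (verts-complete n w))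
  where
  positive : 1 ≤ nbOfColour n ρ u (ρ w) w
  positive rewrite e | ≡ᵇ-refl (ρ w) = ≤-refl

neighbour-of-colour : ∀ n (ρ : V n → ℕ) v c → 1 ≤ nbCount n ρ v c → ∃ λ w → adj n v w ≡ true × ρ w ≡ c
neighbour-of-colour n ρ v c le with positive-term (verts n) (nbOfColour n ρ v c) le
... | w , le' with adj n v w in ea | ρ w ≡ᵇ c in eq
... | true | true = w , ea , ≡ᵇ-sound _ _ eq
... | true | false = ⊥-elim (1+n≰n le')
... | false | _ = ⊥-elim (1+n≰n le')

stable-neighbour : ∀ n (ρ : V n → ℕ) → Stable n ρ → ∀ u v w → ρ u ≡ ρ v → adj n u w ≡ true →
  ∃ λ w' → adj n v w' ≡ true × ρ w' ≡ ρ w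
stable-neighbour n ρ st u v w e a =
  neighbour-of-colour n ρ v (ρ w) (subst (1 ≤_) (st u v e (ρ w)) (count-positive n ρ u w a))

indicators-sum : ∀ K x → x < K → sum (map (λ d → indicator (x ≡ᵇ d)) (downFrom K)) ≡ 1
indicators-sum (suc K) x lt with x ≟ K
... | yes refl rewrite ≡ᵇ-refl x = cong suc (none K ≤-refl)
  where
  none : ∀ K → K ≤ x → sum (map (λ d → indicator (x ≡ᵇ d)) (downFrom K)) ≡ 0
  none zero le = refl
  none (suc K) le rewrite ≢⇒≡ᵇ-false x K (λ e → 1+n≰n (subst (_≤ x) (cong suc (sym e)) le)) =
    none K (≤-trans (n≤1+n K) le)
... | no ne rewrite ≢⇒≡ᵇ-false x K ne = indicators-sum K x (≤∧≢⇒< (≤-pred lt) ne)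

-- Split the sum by the colour d of w:
-- the neighbours of colour d contribute h(d) · |N(u) ∩ ρ⁻¹(d)|.
module WeightedDegree (n : ℕ) (ρ : V n → ℕ) (st : Stable n ρ) (h : V n → ℕ)
                      (h-inv : ∀ w1 w2 → ρ w1 ≡ ρ w2 → h w1 ≡ h w2) where

  -- a bound on all colours in use
  K : ℕ
  K = suc (SV n ρ)

  split-by-colour : ∀ (F : V n → ℕ) → SV n F ≡ sum (map (λ d → SV n (λ w → F w * indicator (ρ w ≡ᵇ d))) (downFrom K))
  split-by-colour F = trans (SV-cong n one) (sum-swap (verts n) (downFrom K) (λ w d → F w * indicator (ρ w ≡ᵇ d)))
    where
    one : ∀ w → F w ≡ sum (map (λ d → F w * indicator (ρ w ≡ᵇ d)) (downFrom K))
    one w = sym (begin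
      sum (map (λ d → F w * indicator (ρ w ≡ᵇ d)) (downFrom K)) ≡⟨ sum-*ˡ (downFrom K) (F w) _ ⟩
      F w * sum (map (λ d → indicator (ρ w ≡ᵇ d)) (downFrom K)) ≡⟨ cong (F w *_) (indicators-sum K (ρ w) (s≤s (term≤sum (verts n) ρ (verts-complete n w)))) ⟩
      F w * 1                                                  ≡⟨ *-identityʳ (F w) ⟩
      F w                                                      ∎)
      where open ≡-Reasoning

  restrict : ∀ u d w → indicator (adj n u w) * h w * indicator (ρ w ≡ᵇ d) ≡ nbOfColour n ρ u d w * h w
  restrict u d w with adj n u w | ρ w ≡ᵇ d
  ... | true | true = *-identityʳ _
  ... | true | false = *-zeroʳ (1 * h w)
  ... | false | _ = *-zeroʳ (0 * h w)

  per-colour : ∀ u v → ρ u ≡ ρ v → ∀ d →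
    SV n (λ w → nbOfColour n ρ u d w * h w) ≡ SV n (λ w → nbOfColour n ρ v d w * h w)
  per-colour u v e d with nbCount n ρ u d in count
  ... | zero = trans (sum-weighted-zero (verts n) _ h count)
                     (sym (sum-weighted-zero (verts n) _ h (trans (sym (st u v e d)) count)))
  ... | suc k with neighbour-of-colour n ρ u d (subst (1 ≤_) (sym count) (s≤s z≤n))
  ...   | w₀ , _ , colour-w₀ = begin
    SV n (λ w → nbOfColour n ρ u d w * h w) ≡⟨ sum-scale (verts n) _ h (h w₀) (only-colour-d u) ⟩
    h w₀ * nbCount n ρ u d                  ≡⟨ cong (h w₀ *_) (st u v e d) ⟩
    h w₀ * nbCount n ρ v d                  ≡⟨ sum-scale (verts n) _ h (h w₀) (only-colour-d v) ⟨
    SV n (λ w → nbOfColour n ρ v d w * h w) ∎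
    where
    open ≡-Reasoning
    only-colour-d : ∀ x y → nbOfColour n ρ x d y ≡ 0 ⊎ h y ≡ h w₀
    only-colour-d x y with adj n x y | ρ y ≡ᵇ d in eq
    ... | true | true = inj₂ (h-inv y w₀ (trans (≡ᵇ-sound _ _ eq) (sym colour-w₀)))
    ... | true | false = inj₁ refl
    ... | false | _ = inj₁ refl

  weighted-degree : ∀ u v → ρ u ≡ ρ v →
    SV n (λ w → indicator (adj n u w) * h w) ≡ SV n (λ w → indicator (adj n v w) * h w)
  weighted-degree u v e = begin
    SV n (λ w → indicator (adj n u w) * h w)
      ≡⟨ split-by-colour _ ⟩
    sum (map (λ d → SV n (λ w → indicator (adj n u w) * h w * indicator (ρ w ≡ᵇ d))) (downFrom K))
      ≡⟨ sum-cong (downFrom K) (λ d → trans (SV-cong n (restrict u d))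
                                     (trans (per-colour u v e d) (sym (SV-cong n (restrict v d))))) ⟩
    sum (map (λ d → SV n (λ w → indicator (adj n v w) * h w * indicator (ρ w ≡ᵇ d))) (downFrom K))
      ≡⟨ split-by-colour _ ⟨
    SV n (λ w → indicator (adj n v w) * h w) ∎
    where open ≡-Reasoning

coarsening-counts : ∀ n (ρ τ : V n → ℕ) → Stable n ρ → (∀ w1 w2 → ρ w1 ≡ ρ w2 → τ w1 ≡ τ w2) →
  ∀ u v → ρ u ≡ ρ v → ∀ c → nbCount n τ u c ≡ nbCount n τ v c
coarsening-counts n ρ τ st τ-inv u v e c = begin
  nbCount n τ u c                                             ≡⟨ nbCount-indicator n τ u c ⟩
  SV n (λ w → indicator (adj n u w) * indicator (τ w ≡ᵇ c)) ≡⟨ weighted-degree u v e ⟩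
  SV n (λ w → indicator (adj n v w) * indicator (τ w ≡ᵇ c)) ≡⟨ nbCount-indicator n τ v c ⟨
  nbCount n τ v c                                             ∎
  where
  open ≡-Reasoning
  open WeightedDegree n ρ st (λ w → indicator (τ w ≡ᵇ c)) (λ w1 w2 e' → cong (λ z → indicator (z ≡ᵇ c)) (τ-inv w1 w2 e'))

V2-cases : (P : V2 → Set) → P a0 → P a1 → P b0 → P b1 → P b2 → P b3 → P c0 → P c1 → P c2 → P c3 → ∀ x → P x
V2-cases P p0 p1 p2 p3 p4 p5 p6 p7 p8 p9 a0 = p0
V2-cases P p0 p1 p2 p3 p4 p5 p6 p7 p8 p9 a1 = p1
V2-cases P p0 p1 p2 p3 p4 p5 p6 p7 p8 p9 b0 = p2
V2-cases P p0 p1 p2 p3 p4 p5 p6 p7 p8 p9 b1 = p3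
V2-cases P p0 p1 p2 p3 p4 p5 p6 p7 p8 p9 b2 = p4
V2-cases P p0 p1 p2 p3 p4 p5 p6 p7 p8 p9 b3 = p5
V2-cases P p0 p1 p2 p3 p4 p5 p6 p7 p8 p9 c0 = p6
V2-cases P p0 p1 p2 p3 p4 p5 p6 p7 p8 p9 c1 = p7
V2-cases P p0 p1 p2 p3 p4 p5 p6 p7 p8 p9 c2 = p8
V2-cases P p0 p1 p2 p3 p4 p5 p6 p7 p8 p9 c3 = p9

code2 : V2 → ℕ
code2 x = V2-cases (λ _ → ℕ) 0 1 2 3 4 5 6 7 8 9 x

decode2 : ℕ → V2
decode2 0 = a0
decode2 1 = a1
decode2 2 = b0
decode2 3 = b1
decode2 4 = b2
decode2 5 = b3
decode2 6 = c0
decode2 7 = c1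
decode2 8 = c2
decode2 _ = c3

decode2-code2 : ∀ x → decode2 (code2 x) ≡ x
decode2-code2 = V2-cases _ refl refl refl refl refl refl refl refl refl refl

_≟₂_ : (x y : V2) → Dec (x ≡ y)
x ≟₂ y = map′ (λ e → trans (sym (decode2-code2 x)) (trans (cong decode2 e) (decode2-code2 y))) (cong code2) (code2 x ≟ code2 y)

∀V2? : {P : V2 → Set} → (∀ x → Dec (P x)) → Dec (∀ x → P x)
∀V2? P? = map′ (λ all x → All.lookup all (verts-complete 1 x)) (λ p → All.tabulate (λ {x} _ → p x)) (All.all? P? verts2)

width : ℕ → ℕ
width m = 2 ^ suc (suc m)

width+0 : (m : ℕ) → width m + 0 ≡ width m
width+0 m = +-identityʳ (width m)

left right : (m : ℕ) → Fin (width m) → Fin (width (suc m))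
left m i = i ↑ˡ (width m + 0)
right m i = width m ↑ʳ cast (sym (width+0 m)) i

toℕ-left : ∀ m i → toℕ (left m i) ≡ toℕ i
toℕ-left m i = Fin.toℕ-↑ˡ i (width m + 0)

toℕ-right : ∀ m i → toℕ (right m i) ≡ width m + toℕ i
toℕ-right m i = trans (Fin.toℕ-↑ʳ (width m) _) (cong (width m +_) (Fin.toℕ-cast (sym (width+0 m)) i))

splitAt-left : ∀ m i → splitAt (width m) (left m i) ≡ inj₁ i
splitAt-left m i = Fin.splitAt-↑ˡ (width m) i (width m + 0)

splitAt-right : ∀ m i → splitAt (width m) (right m i) ≡ inj₂ (cast (sym (width+0 m)) i)
splitAt-right m i = Fin.splitAt-↑ʳ (width m) (width m + 0) _

cast-cancel : ∀ m i → cast (width+0 m) (cast (sym (width+0 m)) i) ≡ i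
cast-cancel m i = Fin.cast-involutive (width+0 m) (sym (width+0 m)) i

index-view : ∀ m (k : Fin (width (suc m))) → (∃ λ i → k ≡ left m i) ⊎ (∃ λ i → k ≡ right m i)
index-view m k with splitAt (width m) k in eq
... | inj₁ i = inj₁ (i , trans (sym (Fin.join-splitAt (width m) (width m + 0) k)) (cong (join (width m) (width m + 0)) eq))
... | inj₂ i = inj₂ (cast (width+0 m) i , trans (sym (Fin.join-splitAt (width m) (width m + 0) k))
                   (trans (cong (join (width m) (width m + 0)) eq) (cong (width m ↑ʳ_) (sym (Fin.cast-involutive (sym (width+0 m)) (width+0 m) i)))))

inT-left : ∀ m i → inTs (suc m) (left m i) ≡ inj₂ (inj₁ (inTs m i))
inT-left m i rewrite splitAt-left m i = refl

inT-right : ∀ m i → inTs (suc m) (right m i) ≡ inj₂ (inj₂ (inTs m i))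
inT-right m i rewrite splitAt-right m i = cong (λ z → inj₂ (inj₂ (inTs m z))) (cast-cancel m i)

inTs-injective : ∀ m i j → inTs m i ≡ inTs m j → i ≡ j
inTs-injective zero = from-yes (Fin.all? λ i → Fin.all? λ j → (inT2 i ≟₂ inT2 j) →-dec (i Fin.≟ j))
inTs-injective (suc m) k l e with index-view m k | index-view m l
... | inj₁ (i , refl) | inj₁ (j , refl) =
  cong (left m) (inTs-injective m i j (inj₁-injective (inj₂-injective (trans (sym (inT-left m i)) (trans e (inT-left m j))))))
... | inj₁ (i , refl) | inj₂ (j , refl) with trans (sym (inT-left m i)) (trans e (inT-right m j))
...   | ()
inTs-injective (suc m) k l e | inj₂ (i , refl) | inj₁ (j , refl) with trans (sym (inT-right m i)) (trans e (inT-left m j))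
...   | ()
inTs-injective (suc m) k l e | inj₂ (i , refl) | inj₂ (j , refl) =
  cong (right m) (inTs-injective m i j (inj₂-injective (inj₂-injective (trans (sym (inT-right m i)) (trans e (inT-right m j))))))

inT-injective : ∀ n i j → inT n i ≡ inT n j → i ≡ j
inT-injective zero F.zero F.zero e = refl
inT-injective zero (F.suc F.zero) (F.suc F.zero) e = refl
inT-injective zero F.zero (F.suc F.zero) ()
inT-injective zero (F.suc F.zero) F.zero ()
inT-injective (suc m) = inTs-injective m

InB-dec : ∀ n (x : V n) → InB n x ⊎ ¬ InB n x
InB-dec zero a0 = inj₂ λ { (F.zero , ()) ; (F.suc F.zero , ()) }
InB-dec zero a1 = inj₂ λ { (F.zero , ()) ; (F.suc F.zero , ()) }
InB-dec zero b0 = inj₁ (F.zero , refl)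
InB-dec zero b1 = inj₁ (F.suc F.zero , refl)
InB-dec (suc zero) x with Fin.any? (λ i → inT2 i ≟₂ x)
... | yes p = inj₁ p
... | no ¬p = inj₂ ¬p
InB-dec (suc (suc m)) (inj₁ x) = inj₂ λ { (k , e) → not-in-G* k e }
  where
  not-in-G* : ∀ k → ¬ inTs (suc m) k ≡ inj₁ x
  not-in-G* k e with index-view m k
  ... | inj₁ (i , refl) with trans (sym (inT-left m i)) e
  ...   | ()
  not-in-G* k e | inj₂ (i , refl) with trans (sym (inT-right m i)) e
  ...   | ()
InB-dec (suc (suc m)) (inj₂ (inj₁ y)) with InB-dec (suc m) y
... | inj₁ (i , e) = inj₁ (left m i , trans (inT-left m i) (cong (inj₂ ∘ inj₁) e))
... | inj₂ ¬B = inj₂ λ { (k , e) → from-G' k e }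
  where
  from-G' : ∀ k → ¬ inTs (suc m) k ≡ inj₂ (inj₁ y)
  from-G' k e with index-view m k
  ... | inj₁ (i , refl) = ¬B (i , inj₁-injective (inj₂-injective (trans (sym (inT-left m i)) e)))
  ... | inj₂ (i , refl) with trans (sym (inT-right m i)) e
  ...   | ()
InB-dec (suc (suc m)) (inj₂ (inj₂ y)) with InB-dec (suc m) y
... | inj₁ (i , e) = inj₁ (right m i , trans (inT-right m i) (cong (inj₂ ∘ inj₂) e))
... | inj₂ ¬B = inj₂ λ { (k , e) → from-G'' k e }
  where
  from-G'' : ∀ k → ¬ inTs (suc m) k ≡ inj₂ (inj₂ y)
  from-G'' k e with index-view m k
  ... | inj₂ (i , refl) = ¬B (i , inj₂-injective (inj₂-injective (trans (sym (inT-right m i)) e)))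
  ... | inj₁ (i , refl) with trans (sym (inT-left m i)) e
  ...   | ()

SameExt-sym : ∀ n ψ u v → SameExt n ψ u v → SameExt n ψ v u
SameExt-sym n ψ u v (inj₁ (i , j , p , q , r)) = inj₁ (j , i , q , p , sym r)
SameExt-sym n ψ u v (inj₂ (a , b)) = inj₂ (b , a)

SameExt-trans : ∀ n ψ u v w → SameExt n ψ u v → SameExt n ψ v w → SameExt n ψ u w
SameExt-trans n ψ u v w (inj₁ (i , j , p , q , r)) (inj₁ (i' , j' , p' , q' , r')) =
  inj₁ (i , j' , p , q' , trans r (trans (cong ψ (inT-injective n j i' (trans q (sym p')))) r'))
SameExt-trans n ψ u v w (inj₁ (i , j , p , q , r)) (inj₂ (a , b)) = ⊥-elim (a (j , q))
SameExt-trans n ψ u v w (inj₂ (a , b)) (inj₁ (i' , j' , p' , q' , r')) = ⊥-elim (b (i' , p'))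
SameExt-trans n ψ u v w (inj₂ (a , b)) (inj₂ (a' , b')) = inj₂ (a , b')

-- Invariance of the vertex sum is recorded explicitly,
-- since the vertex set is given as a list.
record Automorphism (n : ℕ) (σ : V n → V n) (s : Fin (2 ^ suc n) → Fin (2 ^ suc n)) : Set where
  field
    involutive : ∀ x → σ (σ x) ≡ x
    preserves-adj : ∀ x y → adj n (σ x) (σ y) ≡ adj n x y
    preserves-sum : ∀ g → SV n (g ∘ σ) ≡ SV n g
    maps-inT : ∀ i → σ (inT n i) ≡ inT n (s i)

open Automorphism public

-- Since ρ ∘ σ is also stable and refines ψ, it refines ρ,
-- so σ maps ρ-cells to ρ-cells.  Then ρ' = min(ρ, ρ ∘ σ), which merges every cell with its
-- σ-image, is still stable and refines ψ; by maximality ρ' refines ρ, so ρ (σ x) = ρ x.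
module Invariance (n : ℕ) (ψ : Fin (2 ^ suc n) → ℕ) (ρ : V n → ℕ) (cs : CoarsestStableRefining n ψ ρ)
                  (σ : V n → V n) (s : Fin (2 ^ suc n) → Fin (2 ^ suc n)) (A : Automorphism n σ s)
                  (ψ-pres : ∀ i → ψ (s i) ≡ ψ i) where

  private
    stable : Stable n ρ
    stable = proj₁ cs
    refines : RefinesB n ρ ψ
    refines = proj₁ (proj₂ cs)
    coarsest : ∀ ρ'' → Stable n ρ'' → RefinesB n ρ'' ψ → Refines n ρ'' ρ
    coarsest = proj₂ (proj₂ cs)
    invol = involutive A

  same-cell : ∀ x → SameExt n ψ x (σ x)
  same-cell x with InB-dec n x
  ... | inj₁ (i , e) = inj₁ (i , s i , e , trans (sym (maps-inT A i)) (cong σ e) , sym (ψ-pres i))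
  ... | inj₂ ¬B = inj₂ (¬B , λ { (j , e) → ¬B (s j , trans (sym (maps-inT A j)) (trans (cong σ e) (invol x))) })

  count-σ : ∀ (τ : V n → ℕ) u c → nbCount n (τ ∘ σ) u c ≡ nbCount n τ (σ u) c
  count-σ τ u c = trans (SV-cong n (λ w → cong (λ b → if b ∧ (τ (σ w) ≡ᵇ c) then 1 else 0) (sym (preserves-adj A u w))))
                        (preserves-sum A (nbOfColour n τ (σ u) c))

  maps-cells : ∀ u v → ρ u ≡ ρ v → ρ (σ u) ≡ ρ (σ v)
  maps-cells u v e = coarsest (ρ ∘ σ) stable-σ refines-σ (σ u) (σ v)
                       (subst₂ (λ a b → ρ a ≡ ρ b) (sym (invol u)) (sym (invol v)) e)
    where
    stable-σ : Stable n (ρ ∘ σ)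
    stable-σ u v e c = trans (count-σ ρ u c) (trans (stable (σ u) (σ v) e c) (sym (count-σ ρ v c)))
    refines-σ : RefinesB n (ρ ∘ σ) ψ
    refines-σ u v e = SameExt-trans n ψ u (σ u) v (same-cell u)
      (SameExt-trans n ψ (σ u) (σ v) v (refines (σ u) (σ v) e) (SameExt-sym n ψ v (σ v) (same-cell v)))

  ρ' : V n → ℕ
  ρ' w = ρ w ⊓ ρ (σ w)

  ρ'-σ : ∀ w → ρ' (σ w) ≡ ρ' w
  ρ'-σ w = trans (cong (ρ (σ w) ⊓_) (cong ρ (invol w))) (⊓-comm (ρ (σ w)) (ρ w))

  ρ'-cells : ∀ u v → ρ' u ≡ ρ' v → ρ u ≡ ρ v ⊎ ρ u ≡ ρ (σ v)
  ρ'-cells u v e with ⊓-sel (ρ u) (ρ (σ u)) | ⊓-sel (ρ v) (ρ (σ v))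
  ... | inj₁ p | inj₁ q = inj₁ (trans (sym p) (trans e q))
  ... | inj₁ p | inj₂ q = inj₂ (trans (sym p) (trans e q))
  ... | inj₂ p | inj₁ q = inj₂ (trans (sym (cong ρ (invol u))) (maps-cells (σ u) v (trans (sym p) (trans e q))))
  ... | inj₂ p | inj₂ q = inj₁ (trans (sym (cong ρ (invol u)))
                                 (trans (maps-cells (σ u) (σ v) (trans (sym p) (trans e q))) (cong ρ (invol v))))

  -- ρ' is coarser than ρ, so its neighbour counts are constant on ρ-cells
  counts-ρ' : ∀ u v → ρ u ≡ ρ v → ∀ c → nbCount n ρ' u c ≡ nbCount n ρ' v c
  counts-ρ' = coarsening-counts n ρ ρ' stable (λ w1 w2 e → cong₂ _⊓_ e (maps-cells w1 w2 e))

  stable' : Stable n ρ'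
  stable' u v e c with ρ'-cells u v e
  ... | inj₁ p = counts-ρ' u v p c
  ... | inj₂ p = begin
    nbCount n ρ' u c       ≡⟨ counts-ρ' u (σ v) p c ⟩
    nbCount n ρ' (σ v) c   ≡⟨ count-σ ρ' v c ⟨
    nbCount n (ρ' ∘ σ) v c ≡⟨ SV-cong n (λ w → cong (λ z → if adj n v w ∧ (z ≡ᵇ c) then 1 else 0) (ρ'-σ w)) ⟩
    nbCount n ρ' v c       ∎
    where open ≡-Reasoning

  refines' : RefinesB n ρ' ψ
  refines' u v e with ρ'-cells u v e
  ... | inj₁ p = refines u v p
  ... | inj₂ p = SameExt-trans n ψ u (σ v) v (refines u (σ v) p) (SameExt-sym n ψ v (σ v) (same-cell v))

  invariant : ∀ x → ρ (σ x) ≡ ρ x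
  invariant x = sym (coarsest ρ' stable' refines' x (σ x) (sym (ρ'-σ x)))

invariance : ∀ n ψ ρ → CoarsestStableRefining n ψ ρ → ∀ σ s → Automorphism n σ s →
  (∀ i → ψ (s i) ≡ ψ i) → ∀ x → ρ (σ x) ≡ ρ x
invariance n ψ ρ cs σ s A ψ-pres = Invariance.invariant n ψ ρ cs σ s A ψ-pres

OutFix : (n : ℕ) → (V n → V n) → Set
OutFix n σ = ∀ y → isA0 n (σ y) ≡ isA0 n y × isA1 n (σ y) ≡ isA1 n y

OutSwap : (n : ℕ) → (V n → V n) → Set
OutSwap n σ = ∀ y → isA0 n (σ y) ≡ isA1 n y × isA1 n (σ y) ≡ isA0 n y

-- For a permutation τ of V2 everything except invariance of sums is checked by enumeration.
automorphism₂ : (τ : V2 → V2) (s : Fin 4 → Fin 4) → (∀ g → SV 1 (g ∘ τ) ≡ SV 1 g) →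
  {_ : True (∀V2? (λ x → τ (τ x) ≟₂ x) ×-dec ∀V2? (λ x → ∀V2? (λ y → adj2 (τ x) (τ y) Bool.≟ adj2 x y))
             ×-dec Fin.all? (λ i → τ (inT2 i) ≟₂ inT2 (s i)))} →
  Automorphism 1 τ s
automorphism₂ τ s sums {certificate} = record
  { involutive = proj₁ checked ; preserves-adj = proj₁ (proj₂ checked) ; preserves-sum = sums ; maps-inT = proj₂ (proj₂ checked) }
  where checked = toWitness certificate

outFix₂ : (τ : V2 → V2) → {_ : True (∀V2? (λ y → (isA0 1 (τ y) Bool.≟ isA0 1 y) ×-dec (isA1 1 (τ y) Bool.≟ isA1 1 y)))} → OutFix 1 τ
outFix₂ τ {certificate} = toWitness certificate

outSwap₂ : (τ : V2 → V2) → {_ : True (∀V2? (λ y → (isA0 1 (τ y) Bool.≟ isA1 1 y) ×-dec (isA1 1 (τ y) Bool.≟ isA0 1 y)))} → OutSwap 1 τ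
outSwap₂ τ {certificate} = toWitness certificate

-- AND₂ computes a₀/a₁ from the input pairs (b₀,b₁) and (b₂,b₃); its automorphisms flip
-- input pairs (flipping the output when exactly one pair is flipped) or exchange them.

flipFirst : V2 → V2
flipFirst = V2-cases _ a1 a0 b1 b0 b2 b3 c3 c2 c1 c0

s-flipFirst : Fin 4 → Fin 4
s-flipFirst F.zero = F.suc F.zero
s-flipFirst (F.suc F.zero) = F.zero
s-flipFirst (F.suc (F.suc i)) = F.suc (F.suc i)

flipFirst-aut : Automorphism 1 flipFirst s-flipFirst
flipFirst-aut = automorphism₂ flipFirst s-flipFirst λ g → solve 10
  (λ x0 x1 x2 x3 x4 x5 x6 x7 x8 x9 → x1 :+ (x0 :+ (x3 :+ (x2 :+ (x4 :+ (x5 :+ (x9 :+ (x8 :+ (x7 :+ (x6 :+ con 0)))))))))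
                                   := x0 :+ (x1 :+ (x2 :+ (x3 :+ (x4 :+ (x5 :+ (x6 :+ (x7 :+ (x8 :+ (x9 :+ con 0))))))))))
  refl (g a0) (g a1) (g b0) (g b1) (g b2) (g b3) (g c0) (g c1) (g c2) (g c3)

flipSecond : V2 → V2
flipSecond = V2-cases _ a1 a0 b0 b1 b3 b2 c2 c3 c0 c1

s-flipSecond : Fin 4 → Fin 4
s-flipSecond (F.suc (F.suc F.zero)) = F.suc (F.suc (F.suc F.zero))
s-flipSecond (F.suc (F.suc (F.suc F.zero))) = F.suc (F.suc F.zero)
s-flipSecond i = i

flipSecond-aut : Automorphism 1 flipSecond s-flipSecond
flipSecond-aut = automorphism₂ flipSecond s-flipSecond λ g → solve 10
  (λ x0 x1 x2 x3 x4 x5 x6 x7 x8 x9 → x1 :+ (x0 :+ (x2 :+ (x3 :+ (x5 :+ (x4 :+ (x8 :+ (x9 :+ (x6 :+ (x7 :+ con 0)))))))))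
                                   := x0 :+ (x1 :+ (x2 :+ (x3 :+ (x4 :+ (x5 :+ (x6 :+ (x7 :+ (x8 :+ (x9 :+ con 0))))))))))
  refl (g a0) (g a1) (g b0) (g b1) (g b2) (g b3) (g c0) (g c1) (g c2) (g c3)

flipBoth : V2 → V2
flipBoth = V2-cases _ a0 a1 b1 b0 b3 b2 c1 c0 c3 c2

s-flipBoth : Fin 4 → Fin 4
s-flipBoth F.zero = F.suc F.zero
s-flipBoth (F.suc F.zero) = F.zero
s-flipBoth (F.suc (F.suc F.zero)) = F.suc (F.suc (F.suc F.zero))
s-flipBoth (F.suc (F.suc (F.suc F.zero))) = F.suc (F.suc F.zero)

flipBoth-aut : Automorphism 1 flipBoth s-flipBoth
flipBoth-aut = automorphism₂ flipBoth s-flipBoth λ g → solve 10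
  (λ x0 x1 x2 x3 x4 x5 x6 x7 x8 x9 → x0 :+ (x1 :+ (x3 :+ (x2 :+ (x5 :+ (x4 :+ (x7 :+ (x6 :+ (x9 :+ (x8 :+ con 0)))))))))
                                   := x0 :+ (x1 :+ (x2 :+ (x3 :+ (x4 :+ (x5 :+ (x6 :+ (x7 :+ (x8 :+ (x9 :+ con 0))))))))))
  refl (g a0) (g a1) (g b0) (g b1) (g b2) (g b3) (g c0) (g c1) (g c2) (g c3)

swapInputs : V2 → V2
swapInputs = V2-cases _ a0 a1 b2 b3 b0 b1 c1 c0 c2 c3

s-swapInputs : Fin 4 → Fin 4
s-swapInputs F.zero = F.suc (F.suc F.zero)
s-swapInputs (F.suc F.zero) = F.suc (F.suc (F.suc F.zero))
s-swapInputs (F.suc (F.suc F.zero)) = F.zero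
s-swapInputs (F.suc (F.suc (F.suc F.zero))) = F.suc F.zero

swapInputs-aut : Automorphism 1 swapInputs s-swapInputs
swapInputs-aut = automorphism₂ swapInputs s-swapInputs λ g → solve 10
  (λ x0 x1 x2 x3 x4 x5 x6 x7 x8 x9 → x0 :+ (x1 :+ (x4 :+ (x5 :+ (x2 :+ (x3 :+ (x7 :+ (x6 :+ (x8 :+ (x9 :+ con 0)))))))))
                                   := x0 :+ (x1 :+ (x2 :+ (x3 :+ (x4 :+ (x5 :+ (x6 :+ (x7 :+ (x8 :+ (x9 :+ con 0))))))))))
  refl (g a0) (g a1) (g b0) (g b1) (g b2) (g b3) (g c0) (g c1) (g c2) (g c3)

swapFlipped : V2 → V2
swapFlipped = V2-cases _ a0 a1 b3 b2 b1 b0 c0 c1 c3 c2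

s-swapFlipped : Fin 4 → Fin 4
s-swapFlipped F.zero = F.suc (F.suc (F.suc F.zero))
s-swapFlipped (F.suc F.zero) = F.suc (F.suc F.zero)
s-swapFlipped (F.suc (F.suc F.zero)) = F.suc F.zero
s-swapFlipped (F.suc (F.suc (F.suc F.zero))) = F.zero

swapFlipped-aut : Automorphism 1 swapFlipped s-swapFlipped
swapFlipped-aut = automorphism₂ swapFlipped s-swapFlipped λ g → solve 10
  (λ x0 x1 x2 x3 x4 x5 x6 x7 x8 x9 → x0 :+ (x1 :+ (x5 :+ (x4 :+ (x3 :+ (x2 :+ (x6 :+ (x7 :+ (x9 :+ (x8 :+ con 0)))))))))
                                   := x0 :+ (x1 :+ (x2 :+ (x3 :+ (x4 :+ (x5 :+ (x6 :+ (x7 :+ (x8 :+ (x9 :+ con 0))))))))))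
  refl (g a0) (g a1) (g b0) (g b1) (g b2) (g b3) (g c0) (g c1) (g c2) (g c3)

swap₁ : V1 → V1
swap₁ a0 = a1
swap₁ a1 = a0
swap₁ b0 = b1
swap₁ b1 = b0

s-swap₁ : Fin 2 → Fin 2
s-swap₁ F.zero = F.suc F.zero
s-swap₁ (F.suc F.zero) = F.zero

swap₁-aut : Automorphism 0 swap₁ s-swap₁
swap₁-aut = record
  { involutive = λ { a0 → refl ; a1 → refl ; b0 → refl ; b1 → refl }
  ; preserves-adj = λ { a0 a0 → refl ; a0 a1 → refl ; a0 b0 → refl ; a0 b1 → refl
                      ; a1 a0 → refl ; a1 a1 → refl ; a1 b0 → refl ; a1 b1 → refl
                      ; b0 a0 → refl ; b0 a1 → refl ; b0 b0 → refl ; b0 b1 → refl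
                      ; b1 a0 → refl ; b1 a1 → refl ; b1 b0 → refl ; b1 b1 → refl }
  ; preserves-sum = λ g → solve 4 (λ x0 x1 x2 x3 → x1 :+ (x0 :+ (x3 :+ (x2 :+ con 0))) := x0 :+ (x1 :+ (x2 :+ (x3 :+ con 0))))
                            refl (g a0) (g a1) (g b0) (g b1)
  ; maps-inT = λ { F.zero → refl ; (F.suc F.zero) → refl } }

swap₁-outSwap : OutSwap 0 swap₁
swap₁-outSwap a0 = refl , refl
swap₁-outSwap a1 = refl , refl
swap₁-outSwap b0 = refl , refl
swap₁-outSwap b1 = refl , refl

identity-aut : ∀ n → Automorphism n id id
identity-aut n = record { involutive = λ x → refl ; preserves-adj = λ x y → refl ; preserves-sum = λ g → refl ; maps-inT = λ i → refl }

lift : ∀ m → (V2 → V2) → (V (suc m) → V (suc m)) → (V (suc m) → V (suc m)) → V (suc (suc m)) → V (suc (suc m))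
lift m τ σL σR (inj₁ x) = inj₁ (τ x)
lift m τ σL σR (inj₂ (inj₁ y)) = inj₂ (inj₁ (σL y))
lift m τ σL σR (inj₂ (inj₂ y)) = inj₂ (inj₂ (σR y))

lift-index : ∀ m → (Fin (width m) → Fin (width m)) → (Fin (width m) → Fin (width m)) → Fin (width (suc m)) → Fin (width (suc m))
lift-index m sL sR k =
  join (width m) (width m + 0) (Sum.map sL (λ k'' → cast (sym (width+0 m)) (sR (cast (width+0 m) k''))) (splitAt (width m) k))

lift-index-left : ∀ m sL sR i → lift-index m sL sR (left m i) ≡ left m (sL i)
lift-index-left m sL sR i rewrite splitAt-left m i = refl

lift-index-right : ∀ m sL sR i → lift-index m sL sR (right m i) ≡ right m (sR i)
lift-index-right m sL sR i rewrite splitAt-right m i = cong (λ z → width m ↑ʳ cast (sym (width+0 m)) (sR z)) (cast-cancel m i)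

lift-aut : ∀ m τ sτ σL σR sL sR → Automorphism 1 τ sτ →
  (∀ y x → crossL (suc m) (σL y) (τ x) ≡ crossL (suc m) y x) →
  (∀ y x → crossR (suc m) (σR y) (τ x) ≡ crossR (suc m) y x) →
  Automorphism (suc m) σL sL → Automorphism (suc m) σR sR → Automorphism (suc (suc m)) (lift m τ σL σR) (lift-index m sL sR)
lift-aut m τ sτ σL σR sL sR T compatL compatR L R = record
  { involutive = inv ; preserves-adj = adj-pres ; preserves-sum = sum-pres ; maps-inT = inT-pres }
  where
  σ = lift m τ σL σR
  inv : ∀ x → σ (σ x) ≡ x
  inv (inj₁ x) = cong inj₁ (involutive T x)
  inv (inj₂ (inj₁ y)) = cong (inj₂ ∘ inj₁) (involutive L y)
  inv (inj₂ (inj₂ y)) = cong (inj₂ ∘ inj₂) (involutive R y)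
  adj-pres : ∀ x y → adj (suc (suc m)) (σ x) (σ y) ≡ adj (suc (suc m)) x y
  adj-pres (inj₁ x) (inj₁ y) = preserves-adj T x y
  adj-pres (inj₁ x) (inj₂ (inj₁ y)) = compatL y x
  adj-pres (inj₁ x) (inj₂ (inj₂ y)) = compatR y x
  adj-pres (inj₂ (inj₁ x)) (inj₁ y) = compatL x y
  adj-pres (inj₂ (inj₂ x)) (inj₁ y) = compatR x y
  adj-pres (inj₂ (inj₁ x)) (inj₂ (inj₁ y)) = preserves-adj L x y
  adj-pres (inj₂ (inj₂ x)) (inj₂ (inj₂ y)) = preserves-adj R x y
  adj-pres (inj₂ (inj₁ x)) (inj₂ (inj₂ y)) = refl
  adj-pres (inj₂ (inj₂ x)) (inj₂ (inj₁ y)) = refl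
  sum-pres : ∀ g → SV (suc (suc m)) (g ∘ σ) ≡ SV (suc (suc m)) g
  sum-pres g = trans (SV-split m (g ∘ σ))
    (trans (cong₂ _+_ (preserves-sum T (g ∘ inj₁))
                      (cong₂ _+_ (preserves-sum L (g ∘ inj₂ ∘ inj₁)) (preserves-sum R (g ∘ inj₂ ∘ inj₂))))
           (sym (SV-split m g)))
  inT-pres : ∀ k → σ (inTs (suc m) k) ≡ inTs (suc m) (lift-index m sL sR k)
  inT-pres k with index-view m k
  ... | inj₁ (i , refl) = begin
    σ (inTs (suc m) (left m i))                    ≡⟨ cong σ (inT-left m i) ⟩
    inj₂ (inj₁ (σL (inTs m i)))                    ≡⟨ cong (inj₂ ∘ inj₁) (maps-inT L i) ⟩
    inj₂ (inj₁ (inTs m (sL i)))                    ≡⟨ inT-left m (sL i) ⟨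
    inTs (suc m) (left m (sL i))                   ≡⟨ cong (inTs (suc m)) (lift-index-left m sL sR i) ⟨
    inTs (suc m) (lift-index m sL sR (left m i))   ∎
    where open ≡-Reasoning
  ... | inj₂ (i , refl) = begin
    σ (inTs (suc m) (right m i))                   ≡⟨ cong σ (inT-right m i) ⟩
    inj₂ (inj₂ (σR (inTs m i)))                    ≡⟨ cong (inj₂ ∘ inj₂) (maps-inT R i) ⟩
    inj₂ (inj₂ (inTs m (sR i)))                    ≡⟨ inT-right m (sR i) ⟨
    inTs (suc m) (right m (sR i))                  ≡⟨ cong (inTs (suc m)) (lift-index-right m sL sR i) ⟨
    inTs (suc m) (lift-index m sL sR (right m i))  ∎
    where open ≡-Reasoning

isA0-G* : ∀ m x → isA0 (suc (suc m)) (inj₁ x) ≡ isA0 1 x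
isA0-G* m = V2-cases _ refl refl refl refl refl refl refl refl refl refl

isA1-G* : ∀ m x → isA1 (suc (suc m)) (inj₁ x) ≡ isA1 1 x
isA1-G* m = V2-cases _ refl refl refl refl refl refl refl refl refl refl

lift-outFix : ∀ m τ σL σR → OutFix 1 τ → OutFix (suc (suc m)) (lift m τ σL σR)
lift-outFix m τ σL σR fix (inj₁ x) rewrite isA0-G* m (τ x) | isA1-G* m (τ x) | isA0-G* m x | isA1-G* m x = fix x
lift-outFix m τ σL σR fix (inj₂ (inj₁ y)) = refl , refl
lift-outFix m τ σL σR fix (inj₂ (inj₂ y)) = refl , refl

lift-outSwap : ∀ m τ σL σR → OutSwap 1 τ → OutSwap (suc (suc m)) (lift m τ σL σR)
lift-outSwap m τ σL σR sw (inj₁ x) rewrite isA0-G* m (τ x) | isA1-G* m (τ x) | isA0-G* m x | isA1-G* m x = sw x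
lift-outSwap m τ σL σR sw (inj₂ (inj₁ y)) = refl , refl
lift-outSwap m τ σL σR sw (inj₂ (inj₂ y)) = refl , refl

-- Compatibility with the connecting edges, which only see the out-terminals of G', G''.

crossL-outFix : ∀ n (σ : V n → V n) → OutFix n σ → ∀ y x → crossL n (σ y) x ≡ crossL n y x
crossL-outFix n σ fix y = V2-cases _ refl refl (proj₁ (fix y)) (proj₂ (fix y)) refl refl refl refl refl refl

crossR-outFix : ∀ n (σ : V n → V n) → OutFix n σ → ∀ y x → crossR n (σ y) x ≡ crossR n y x
crossR-outFix n σ fix y = V2-cases _ refl refl refl refl (proj₁ (fix y)) (proj₂ (fix y)) refl refl refl refl

crossL-flipFirst : ∀ n (σ : V n → V n) → OutSwap n σ → ∀ y x → crossL n (σ y) (flipFirst x) ≡ crossL n y x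
crossL-flipFirst n σ sw y = V2-cases _ refl refl (proj₂ (sw y)) (proj₁ (sw y)) refl refl refl refl refl refl

crossR-flipSecond : ∀ n (σ : V n → V n) → OutSwap n σ → ∀ y x → crossR n (σ y) (flipSecond x) ≡ crossR n y x
crossR-flipSecond n σ sw y = V2-cases _ refl refl refl refl (proj₂ (sw y)) (proj₁ (sw y)) refl refl refl refl

crossR-flipFirst : ∀ n (y : V n) x → crossR n y (flipFirst x) ≡ crossR n y x
crossR-flipFirst n y = V2-cases _ refl refl refl refl refl refl refl refl refl refl

crossL-flipSecond : ∀ n (y : V n) x → crossL n y (flipSecond x) ≡ crossL n y x
crossL-flipSecond n y = V2-cases _ refl refl refl refl refl refl refl refl refl refl

inLeft : ∀ m σ s → Automorphism (suc m) σ s → OutFix (suc m) σ → Automorphism (suc (suc m)) (lift m id σ id) (lift-index m s id)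
inLeft m σ s A fix = lift-aut m id id σ id s id (identity-aut 1) (crossL-outFix (suc m) σ fix) (λ y x → refl) A (identity-aut (suc m))

inRight : ∀ m σ s → Automorphism (suc m) σ s → OutFix (suc m) σ → Automorphism (suc (suc m)) (lift m id id σ) (lift-index m id s)
inRight m σ s A fix = lift-aut m id id id σ id s (identity-aut 1) (λ y x → refl) (crossR-outFix (suc m) σ fix) (identity-aut (suc m)) A

flipLeft : ∀ m σ s → Automorphism (suc m) σ s → OutSwap (suc m) σ → Automorphism (suc (suc m)) (lift m flipFirst σ id) (lift-index m s id)
flipLeft m σ s A sw = lift-aut m flipFirst s-flipFirst σ id s id flipFirst-aut (crossL-flipFirst (suc m) σ sw) (crossR-flipFirst (suc m)) A (identity-aut (suc m))

flipRight : ∀ m σ s → Automorphism (suc m) σ s → OutSwap (suc m) σ → Automorphism (suc (suc m)) (lift m flipSecond id σ) (lift-index m id s)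
flipRight m σ s A sw = lift-aut m flipSecond s-flipSecond id σ id s flipSecond-aut (crossL-flipSecond (suc m)) (crossR-flipSecond (suc m) σ sw) (identity-aut (suc m)) A

swapHalves : ∀ m → V (suc (suc m)) → V (suc (suc m))
swapHalves m (inj₁ x) = inj₁ (swapInputs x)
swapHalves m (inj₂ (inj₁ y)) = inj₂ (inj₂ y)
swapHalves m (inj₂ (inj₂ y)) = inj₂ (inj₁ y)

swap-index : ∀ m → Fin (width (suc m)) → Fin (width (suc m))
swap-index m k = join (width m) (width m + 0) (Sum.swap (Sum.map (cast (sym (width+0 m))) (cast (width+0 m)) (splitAt (width m) k)))

swap-index-left : ∀ m i → swap-index m (left m i) ≡ right m i
swap-index-left m i rewrite splitAt-left m i = refl

swap-index-right : ∀ m i → swap-index m (right m i) ≡ left m i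
swap-index-right m i rewrite splitAt-right m i = cong (_↑ˡ (width m + 0)) (cast-cancel m i)

crossR-swapInputs : ∀ n (y : V n) x → crossR n y (swapInputs x) ≡ crossL n y x
crossR-swapInputs n y = V2-cases _ refl refl refl refl refl refl refl refl refl refl

crossL-swapInputs : ∀ n (y : V n) x → crossL n y (swapInputs x) ≡ crossR n y x
crossL-swapInputs n y = V2-cases _ refl refl refl refl refl refl refl refl refl refl

swapHalves-aut : ∀ m → Automorphism (suc (suc m)) (swapHalves m) (swap-index m)
swapHalves-aut m = record { involutive = inv ; preserves-adj = adj-pres ; preserves-sum = sum-pres ; maps-inT = inT-pres }
  where
  inv : ∀ x → swapHalves m (swapHalves m x) ≡ x
  inv (inj₁ x) = cong inj₁ (involutive swapInputs-aut x)
  inv (inj₂ (inj₁ y)) = refl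
  inv (inj₂ (inj₂ y)) = refl
  adj-pres : ∀ x y → adj (suc (suc m)) (swapHalves m x) (swapHalves m y) ≡ adj (suc (suc m)) x y
  adj-pres (inj₁ x) (inj₁ y) = preserves-adj swapInputs-aut x y
  adj-pres (inj₁ x) (inj₂ (inj₁ y)) = crossR-swapInputs (suc m) y x
  adj-pres (inj₁ x) (inj₂ (inj₂ y)) = crossL-swapInputs (suc m) y x
  adj-pres (inj₂ (inj₁ x)) (inj₁ y) = crossR-swapInputs (suc m) x y
  adj-pres (inj₂ (inj₂ x)) (inj₁ y) = crossL-swapInputs (suc m) x y
  adj-pres (inj₂ (inj₁ x)) (inj₂ (inj₁ y)) = refl
  adj-pres (inj₂ (inj₂ x)) (inj₂ (inj₂ y)) = refl
  adj-pres (inj₂ (inj₁ x)) (inj₂ (inj₂ y)) = refl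
  adj-pres (inj₂ (inj₂ x)) (inj₂ (inj₁ y)) = refl
  sum-pres : ∀ g → SV (suc (suc m)) (g ∘ swapHalves m) ≡ SV (suc (suc m)) g
  sum-pres g = trans (SV-split m (g ∘ swapHalves m))
    (trans (cong₂ _+_ (preserves-sum swapInputs-aut (g ∘ inj₁)) (+-comm (SV (suc m) (g ∘ inj₂ ∘ inj₂)) _))
           (sym (SV-split m g)))
  inT-pres : ∀ k → swapHalves m (inTs (suc m) k) ≡ inTs (suc m) (swap-index m k)
  inT-pres k with index-view m k
  ... | inj₁ (i , refl) = trans (cong (swapHalves m) (inT-left m i)) (trans (sym (inT-right m i)) (cong (inTs (suc m)) (sym (swap-index-left m i))))
  ... | inj₂ (i , refl) = trans (cong (swapHalves m) (inT-right m i)) (trans (sym (inT-left m i)) (cong (inTs (suc m)) (sym (swap-index-right m i))))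

swapHalves-outFix : ∀ m → OutFix (suc (suc m)) (swapHalves m)
swapHalves-outFix m (inj₁ x) rewrite isA0-G* m (swapInputs x) | isA1-G* m (swapInputs x) | isA0-G* m x | isA1-G* m x = outFix₂ swapInputs x
swapHalves-outFix m (inj₂ (inj₁ y)) = refl , refl
swapHalves-outFix m (inj₂ (inj₂ y)) = refl , refl

InBlockℕ : ℕ → ℕ → ℕ → Set
InBlockℕ e q t = q * 2 ^ e ≤ t × t < suc q * 2 ^ e

InBlock : ℕ → ℕ → {N : ℕ} → Fin N → Set
InBlock e q k = InBlockℕ e q (toℕ k)

ConstantOn : {A : Set} → (A → ℕ) → (A → Set) → Set
ConstantOn f P = ∀ k l → P k → P l → f k ≡ f l

block-shift : ∀ e p q t → InBlockℕ e (p + q) (p * 2 ^ e + t) ⇔ InBlockℕ e q t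
block-shift e p q t = mk⇔
  (λ (lo , hi) → +-cancelˡ-≤ (p * 2 ^ e) _ _ (subst (_≤ p * 2 ^ e + t) low lo) ,
                 +-cancelˡ-< (p * 2 ^ e) _ _ (subst (p * 2 ^ e + t <_) high hi))
  (λ (lo , hi) → subst (_≤ p * 2 ^ e + t) (sym low) (+-monoʳ-≤ (p * 2 ^ e) lo) ,
                 subst (p * 2 ^ e + t <_) (sym high) (+-monoʳ-< (p * 2 ^ e) hi))
  where
  low : (p + q) * 2 ^ e ≡ p * 2 ^ e + q * 2 ^ e
  low = *-distribʳ-+ (2 ^ e) p q
  high : suc (p + q) * 2 ^ e ≡ p * 2 ^ e + suc q * 2 ^ e
  high = trans (cong (_* 2 ^ e) (sym (+-suc p q))) (*-distribʳ-+ (2 ^ e) p (suc q))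

block-below : ∀ e p q t → q < p → InBlockℕ e q t → t < p * 2 ^ e
block-below e p q t q<p (_ , hi) = <-≤-trans hi (*-monoˡ-≤ (2 ^ e) q<p)

block-above : ∀ e p q t → p ≤ q → InBlockℕ e q t → p * 2 ^ e ≤ t
block-above e p q t p≤q (lo , _) = ≤-trans (*-monoˡ-≤ (2 ^ e) p≤q) lo

data HalfOf (m e q : ℕ) : Set where
  in-left : (∀ i → InBlock e q (left m i) ⇔ InBlock e q i) →
            (∀ k → InBlock e q k → ∃ λ i → k ≡ left m i) → HalfOf m e q
  in-right : (q' : ℕ) → (∀ i → InBlock e q (right m i) ⇔ InBlock e q' i) →
             (∀ k → InBlock e q k → ∃ λ i → k ≡ right m i) → HalfOf m e q

subst-⇔ : {A : Set} (P : A → Set) {a b : A} → a ≡ b → P a ⇔ P b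
subst-⇔ P refl = mk⇔ id id

width-blocks : ∀ m jj e → jj + e ≡ suc (suc m) → width m ≡ 2 ^ jj * 2 ^ e
width-blocks m jj e eq = trans (cong (2 ^_) (sym eq)) (^-distribˡ-+-* 2 jj e)

half-of : ∀ m jj e q → jj + e ≡ suc (suc m) → HalfOf m e q
half-of m jj e q eq with q <? 2 ^ jj
... | yes q<p = in-left (λ i → subst-⇔ (InBlockℕ e q) (toℕ-left m i)) onto
  where
  onto : ∀ k → InBlock e q k → ∃ λ i → k ≡ left m i
  onto k b with index-view m k
  ... | inj₁ (i , e) = i , e
  ... | inj₂ (i , refl) = ⊥-elim (<⇒≱ (block-below e (2 ^ jj) q _ q<p b)
          (≤-trans (≤-reflexive (sym (width-blocks m jj e eq))) (≤-trans (m≤m+n (width m) (toℕ i)) (≤-reflexive (sym (toℕ-right m i))))))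
... | no q≮p = in-right q' shifted onto
  where
  p = 2 ^ jj
  q' = q ∸ p
  q-split : p + q' ≡ q
  q-split = m+[n∸m]≡n (≮⇒≥ q≮p)
  shifted : ∀ i → InBlock e q (right m i) ⇔ InBlock e q' i
  shifted i = subst (λ z → InBlockℕ e z (toℕ (right m i)) ⇔ InBlockℕ e q' (toℕ i)) q-split
    (subst (λ z → InBlockℕ e (p + q') z ⇔ InBlockℕ e q' (toℕ i))
      (sym (trans (toℕ-right m i) (cong (_+ toℕ i) (width-blocks m jj e eq)))) (block-shift e p q' (toℕ i)))
  onto : ∀ k → InBlock e q k → ∃ λ i → k ≡ right m i
  onto k b with index-view m k
  ... | inj₂ (i , e) = i , e
  ... | inj₁ (i , refl) = ⊥-elim (<⇒≱ (subst (_< width m) (sym (toℕ-left m i)) (Fin.toℕ<n i))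
          (≤-trans (≤-reflexive (width-blocks m jj e eq)) (block-above e p q _ (≮⇒≥ q≮p) b)))

Invariant : (n : ℕ) → (V n → ℕ) → (Fin (2 ^ suc n) → ℕ) → Set
Invariant n ρ ψ = ∀ σ s → Automorphism n σ s → OutFix n σ → (∀ i → ψ (s i) ≡ ψ i) → ∀ x → ρ (σ x) ≡ ρ x

-- invariance passes to G' and G'' (extend automorphisms by the identity)
invariant-left : ∀ m ρ ψ → Invariant (suc (suc m)) ρ ψ → Invariant (suc m) (ρ ∘ inj₂ ∘ inj₁) (ψ ∘ left m)
invariant-left m ρ ψ inv σ s A fix pres x =
  inv (lift m id σ id) (lift-index m s id) (inLeft m σ s A fix) (lift-outFix m id σ id (λ _ → refl , refl)) pres' (inj₂ (inj₁ x))
  where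
  pres' : ∀ k → ψ (lift-index m s id k) ≡ ψ k
  pres' k with index-view m k
  ... | inj₁ (i , refl) = trans (cong ψ (lift-index-left m s id i)) (pres i)
  ... | inj₂ (i , refl) = cong ψ (lift-index-right m s id i)

invariant-right : ∀ m ρ ψ → Invariant (suc (suc m)) ρ ψ → Invariant (suc m) (ρ ∘ inj₂ ∘ inj₂) (ψ ∘ right m)
invariant-right m ρ ψ inv σ s A fix pres x =
  inv (lift m id id σ) (lift-index m id s) (inRight m σ s A fix) (lift-outFix m id id σ (λ _ → refl , refl)) pres' (inj₂ (inj₂ x))
  where
  pres' : ∀ k → ψ (lift-index m id s k) ≡ ψ k
  pres' k with index-view m k
  ... | inj₁ (i , refl) = cong ψ (lift-index-left m id s i)
  ... | inj₂ (i , refl) = trans (cong ψ (lift-index-right m id s i)) (pres i)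

-- If ψ is constant on all of B then so is ρ: in AND₂ the automorphisms flipBoth, swapInputs,
-- swapFlipped move b₀ to every other in-terminal; in AND_ℓ, ℓ ≥ 3, swapHalves moves G'' onto G'.
collapse-all : ∀ m ρ ψ → Invariant (suc m) ρ ψ → (∀ i j → ψ i ≡ ψ j) → ∀ i j → ρ (inTs m i) ≡ ρ (inTs m j)
collapse-all zero ρ ψ inv ψ-const i j = trans (to-b0 i) (sym (to-b0 j))
  where
  by : ∀ τ s → Automorphism 1 τ s → OutFix 1 τ → ρ (τ b0) ≡ ρ b0
  by τ s A fix = inv τ s A fix (λ i → ψ-const _ _) b0
  to-b0 : ∀ i → ρ (inT2 i) ≡ ρ b0
  to-b0 F.zero = refl
  to-b0 (F.suc F.zero) = by flipBoth s-flipBoth flipBoth-aut (outFix₂ flipBoth)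
  to-b0 (F.suc (F.suc F.zero)) = by swapInputs s-swapInputs swapInputs-aut (outFix₂ swapInputs)
  to-b0 (F.suc (F.suc (F.suc F.zero))) = by swapFlipped s-swapFlipped swapFlipped-aut (outFix₂ swapFlipped)
collapse-all (suc m) ρ ψ inv ψ-const k l with into-G' k | into-G' l
  where
  into-G' : ∀ k → ∃ λ i → ρ (inTs (suc m) k) ≡ ρ (inj₂ (inj₁ (inTs m i)))
  into-G' k with index-view m k
  ... | inj₁ (i , refl) = i , cong ρ (inT-left m i)
  ... | inj₂ (i , refl) = i , trans (cong ρ (inT-right m i))
          (sym (inv (swapHalves m) (swap-index m) (swapHalves-aut m) (swapHalves-outFix m) (λ _ → ψ-const _ _) (inj₂ (inj₂ (inTs m i)))))
... | i , p | j , q = trans p (trans (collapse-all m (ρ ∘ inj₂ ∘ inj₁) (ψ ∘ left m) (invariant-left m ρ ψ inv) (λ a b → ψ-const _ _) i j) (sym q))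

collapse-via-child : ∀ m (ρ : V (suc (suc m)) → ℕ) (ψ : Fin (width (suc m)) → ℕ) e q q'
  (emb : Fin (width m) → Fin (width (suc m))) (child : V (suc m) → V (suc (suc m))) →
  (∀ i → inTs (suc m) (emb i) ≡ child (inTs m i)) →
  (∀ i → InBlock e q (emb i) ⇔ InBlock e q' i) → (∀ k → InBlock e q k → ∃ λ i → k ≡ emb i) →
  (ConstantOn (ψ ∘ emb) (InBlock e q') → ConstantOn (ρ ∘ child ∘ inTs m) (InBlock e q')) →
  ConstantOn ψ (InBlock e q) → ConstantOn (ρ ∘ inTs (suc m)) (InBlock e q)
collapse-via-child m ρ ψ e q q' emb child inT-emb block⇔ onto inside cst k l bk bl
  with onto k bk | onto l bl
... | i , refl | j , refl = begin
  ρ (inTs (suc m) (emb i)) ≡⟨ cong ρ (inT-emb i) ⟩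
  ρ (child (inTs m i))     ≡⟨ inside cst' i j (Equivalence.to (block⇔ i) bk) (Equivalence.to (block⇔ j) bl) ⟩
  ρ (child (inTs m j))     ≡⟨ cong ρ (inT-emb j) ⟨
  ρ (inTs (suc m) (emb j)) ∎
  where
  open ≡-Reasoning
  cst' : ConstantOn (ψ ∘ emb) (InBlock e q')
  cst' a b ba bb = cst (emb a) (emb b) (Equivalence.from (block⇔ a) ba) (Equivalence.from (block⇔ b) bb)

-- Blocks of size ≥ 4 on which ψ is constant collapse under ρ: descend to the smallest
-- subgadget containing the block, where it is the whole of B.
collapse-block : ∀ m ρ ψ → Invariant (suc m) ρ ψ → ∀ jj q e → jj + e ≡ suc (suc m) → 2 ≤ e →
  ConstantOn ψ (InBlock e q) → ConstantOn (ρ ∘ inTs m) (InBlock e q)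
collapse-block m ρ ψ inv zero zero .(suc (suc m)) refl _ cst =
  λ i j _ _ → collapse-all m ρ ψ inv (λ k l → cst k l (whole k) (whole l)) i j
  where
  whole : ∀ k → InBlock (suc (suc m)) zero k
  whole k = z≤n , subst (toℕ k <_) (sym (+-identityʳ _)) (Fin.toℕ<n k)
collapse-block m ρ ψ inv zero (suc q) .(suc (suc m)) refl _ cst =
  λ i j bi _ → ⊥-elim (<⇒≱ (Fin.toℕ<n i) (≤-trans (m≤m+n (2 ^ suc (suc m)) _) (proj₁ bi)))
collapse-block zero ρ ψ inv (suc jj) q e eq 2≤e cst =
  ⊥-elim (<⇒≱ (s≤s (≤-trans (m≤n+m e jj) (≤-reflexive (suc-injective eq)))) 2≤e)
collapse-block (suc m) ρ ψ inv (suc jj) q e eq 2≤e cst with half-of m jj e q (suc-injective eq)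
... | in-left block⇔ onto =
  collapse-via-child m ρ ψ e q q (left m) (inj₂ ∘ inj₁) (inT-left m) block⇔ onto
    (collapse-block m (ρ ∘ inj₂ ∘ inj₁) (ψ ∘ left m) (invariant-left m ρ ψ inv) jj q e (suc-injective eq) 2≤e) cst
... | in-right q' block⇔ onto =
  collapse-via-child m ρ ψ e q q' (right m) (inj₂ ∘ inj₂) (inT-right m) block⇔ onto
    (collapse-block m (ρ ∘ inj₂ ∘ inj₂) (ψ ∘ right m) (invariant-right m ρ ψ inv) jj q' e (suc-injective eq) 2≤e) cst

-- In-terminal pairs {b_{2p}, b_{2p+1}}: the partner of index t is t xor 1.

partner : ℕ → ℕ
partner zero = 1
partner (suc zero) = 0
partner (suc (suc t)) = suc (suc (partner t))

partner-shift : ∀ a t → partner (a + a + t) ≡ a + a + partner t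
partner-shift zero t = refl
partner-shift (suc a) t rewrite +-suc a a = cong (suc ∘ suc) (partner-shift a t)

partner-even : ∀ p → partner (p + p) ≡ suc (p + p)
partner-even p = begin
  partner (p + p)         ≡⟨ cong partner (+-identityʳ (p + p)) ⟨
  partner (p + p + 0)     ≡⟨ partner-shift p 0 ⟩
  p + p + 1               ≡⟨ +-comm (p + p) 1 ⟩
  suc (p + p)             ∎
  where open ≡-Reasoning

partner-odd : ∀ p → partner (suc (p + p)) ≡ p + p
partner-odd p = begin
  partner (suc (p + p))   ≡⟨ cong partner (+-comm 1 (p + p)) ⟩
  partner (p + p + 1)     ≡⟨ partner-shift p 1 ⟩
  p + p + 0               ≡⟨ +-identityʳ (p + p) ⟩
  p + p                   ∎
  where open ≡-Reasoning

partner-width : ∀ m t → partner (width m + t) ≡ width m + partner t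
partner-width m t rewrite +-identityʳ (2 ^ suc m) = partner-shift (2 ^ suc m) t

MovesOnly : {N : ℕ} → (Fin N → Fin N) → Fin N → Set
MovesOnly s k = ∀ l → s l ≡ l ⊎ l ≡ k ⊎ s l ≡ k

movesOnly? : {N : ℕ} (s : Fin N → Fin N) (k : Fin N) → Dec (MovesOnly s k)
movesOnly? s k = Fin.all? λ l → (s l Fin.≟ l) ⊎-dec (l Fin.≟ k) ⊎-dec (s l Fin.≟ k)

movesOnly-left : ∀ m s i → MovesOnly s i → MovesOnly (lift-index m s id) (left m i)
movesOnly-left m s i moves l with index-view m l
... | inj₂ (j , refl) = inj₁ (lift-index-right m s id j)
... | inj₁ (j , refl) with moves j
...   | inj₁ e = inj₁ (trans (lift-index-left m s id j) (cong (left m) e))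
...   | inj₂ (inj₁ e) = inj₂ (inj₁ (cong (left m) e))
...   | inj₂ (inj₂ e) = inj₂ (inj₂ (trans (lift-index-left m s id j) (cong (left m) e)))

movesOnly-right : ∀ m s i → MovesOnly s i → MovesOnly (lift-index m id s) (right m i)
movesOnly-right m s i moves l with index-view m l
... | inj₁ (j , refl) = inj₁ (lift-index-left m id s j)
... | inj₂ (j , refl) with moves j
...   | inj₁ e = inj₁ (trans (lift-index-right m id s j) (cong (right m) e))
...   | inj₂ (inj₁ e) = inj₂ (inj₁ (cong (right m) e))
...   | inj₂ (inj₂ e) = inj₂ (inj₂ (trans (lift-index-right m id s j) (cong (right m) e)))

-- For every in-terminal b_k there is an automorphism exchanging b_k with its partner,
-- fixing all other in-terminals and exchanging the out-terminals: it flips the gadgets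
-- along the path from b_k to the output.
record PairFlip (n : ℕ) (k : Fin (2 ^ suc n)) : Set where
  field
    σ : V n → V n
    s : Fin (2 ^ suc n) → Fin (2 ^ suc n)
    automorphism : Automorphism n σ s
    swaps-out : OutSwap n σ
    moves-only : MovesOnly s k
    to-partner : toℕ (s k) ≡ partner (toℕ k)

flip-first : ∀ k → toℕ (s-flipFirst k) ≡ partner (toℕ k) → {True (movesOnly? s-flipFirst k)} → PairFlip 1 k
flip-first k p {c} = record
  { σ = flipFirst ; s = s-flipFirst ; automorphism = flipFirst-aut ; swaps-out = outSwap₂ flipFirst
  ; moves-only = toWitness c ; to-partner = p }
flip-second : ∀ k → toℕ (s-flipSecond k) ≡ partner (toℕ k) → {True (movesOnly? s-flipSecond k)} → PairFlip 1 k
flip-second k p {c} = record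
  { σ = flipSecond ; s = s-flipSecond ; automorphism = flipSecond-aut ; swaps-out = outSwap₂ flipSecond
  ; moves-only = toWitness c ; to-partner = p }

pair-flip-left : ∀ m i → PairFlip (suc m) i → PairFlip (suc (suc m)) (left m i)
pair-flip-left m i F = record
  { σ = lift m flipFirst σ id ; s = lift-index m s id ; automorphism = flipLeft m σ s automorphism swaps-out
  ; swaps-out = lift-outSwap m flipFirst σ id (outSwap₂ flipFirst) ; moves-only = movesOnly-left m s i moves-only
  ; to-partner = begin
      toℕ (lift-index m s id (left m i)) ≡⟨ cong toℕ (lift-index-left m s id i) ⟩
      toℕ (left m (s i))                 ≡⟨ toℕ-left m (s i) ⟩
      toℕ (s i)                          ≡⟨ to-partner ⟩
      partner (toℕ i)                    ≡⟨ cong partner (toℕ-left m i) ⟨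
      partner (toℕ (left m i))           ∎ }
  where
  open PairFlip F
  open ≡-Reasoning

pair-flip-right : ∀ m i → PairFlip (suc m) i → PairFlip (suc (suc m)) (right m i)
pair-flip-right m i F = record
  { σ = lift m flipSecond id σ ; s = lift-index m id s ; automorphism = flipRight m σ s automorphism swaps-out
  ; swaps-out = lift-outSwap m flipSecond id σ (outSwap₂ flipSecond) ; moves-only = movesOnly-right m s i moves-only
  ; to-partner = begin
      toℕ (lift-index m id s (right m i)) ≡⟨ cong toℕ (lift-index-right m id s i) ⟩
      toℕ (right m (s i))                 ≡⟨ toℕ-right m (s i) ⟩
      width m + toℕ (s i)                 ≡⟨ cong (width m +_) to-partner ⟩
      width m + partner (toℕ i)           ≡⟨ partner-width m (toℕ i) ⟨
      partner (width m + toℕ i)           ≡⟨ cong partner (toℕ-right m i) ⟨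
      partner (toℕ (right m i))           ∎ }
  where
  open PairFlip F
  open ≡-Reasoning

pair-flip⁺ : ∀ m k → PairFlip (suc m) k
pair-flip⁺ zero F.zero = flip-first F.zero refl
pair-flip⁺ zero (F.suc F.zero) = flip-first (F.suc F.zero) refl
pair-flip⁺ zero (F.suc (F.suc F.zero)) = flip-second (F.suc (F.suc F.zero)) refl
pair-flip⁺ zero (F.suc (F.suc (F.suc F.zero))) = flip-second (F.suc (F.suc (F.suc F.zero))) refl
pair-flip⁺ (suc m) k with index-view m k
... | inj₁ (i , refl) = pair-flip-left m i (pair-flip⁺ m i)
... | inj₂ (i , refl) = pair-flip-right m i (pair-flip⁺ m i)

pair-flip : ∀ n k → PairFlip n k
pair-flip zero k = record
  { σ = swap₁ ; s = s-swap₁ ; automorphism = swap₁-aut ; swaps-out = swap₁-outSwap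
  ; moves-only = from-yes (Fin.all? λ k → movesOnly? s-swap₁ k) k ; to-partner = partner-of k }
  where
  partner-of : ∀ k → toℕ (s-swap₁ k) ≡ partner (toℕ k)
  partner-of F.zero = refl
  partner-of (F.suc F.zero) = refl
pair-flip (suc m) = pair-flip⁺ m

index-involutive : ∀ n σ s → Automorphism n σ s → ∀ l → s (s l) ≡ l
index-involutive n σ s A l = inT-injective n (s (s l)) l (begin
  inT n (s (s l)) ≡⟨ maps-inT A (s l) ⟨
  σ (inT n (s l)) ≡⟨ cong σ (maps-inT A l) ⟨
  σ (σ (inT n l)) ≡⟨ involutive A (inT n l) ⟩
  inT n l         ∎)
  where open ≡-Reasoning

movesOnly-preserves : ∀ {N} (ψ : Fin N → ℕ) s k → (∀ l → s (s l) ≡ l) → MovesOnly s k →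
  ψ (s k) ≡ ψ k → ∀ l → ψ (s l) ≡ ψ l
movesOnly-preserves ψ s k invol moves e l with moves l
... | inj₁ fixed = cong ψ fixed
... | inj₂ (inj₁ refl) = e
... | inj₂ (inj₂ sl≡k) = begin
  ψ (s l)     ≡⟨ cong ψ sl≡k ⟩
  ψ k         ≡⟨ e ⟨
  ψ (s k)     ≡⟨ cong (ψ ∘ s) sl≡k ⟨
  ψ (s (s l)) ≡⟨ cong ψ (invol l) ⟩
  ψ l         ∎
  where open ≡-Reasoning

isA0-out0 : ∀ n → isA0 n (out n F.zero) ≡ true
isA0-out0 zero = refl
isA0-out0 (suc zero) = refl
isA0-out0 (suc (suc n)) = refl

isA1⇒out1 : ∀ n x → isA1 n x ≡ true → x ≡ out n (F.suc F.zero)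
isA1⇒out1 zero a1 _ = refl
isA1⇒out1 (suc zero) x = V2-cases (λ x → isA1 1 x ≡ true → x ≡ a1) (λ ()) (λ _ → refl) (λ ()) (λ ()) (λ ()) (λ ()) (λ ()) (λ ()) (λ ()) (λ ()) x
isA1⇒out1 (suc (suc n)) (inj₁ x) e = cong inj₁ (isA1⇒out1 (suc zero) x (trans (sym (isA1-G* n x)) e))

-- If ψ does not distinguish b_k from its partner b_k', then ρ merges b_k with b_k'
-- and a₀ with a₁: the pair flip of b_k is ψ-preserving, so ρ is invariant under it.
pair-collapse : ∀ n ψ ρ → CoarsestStableRefining n ψ ρ → ∀ k k' → toℕ k' ≡ partner (toℕ k) → ψ k ≡ ψ k' →
  ρ (inT n k) ≡ ρ (inT n k') × ρ (out n F.zero) ≡ ρ (out n (F.suc F.zero))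
pair-collapse n ψ ρ cs k k' k'-partner ψ-pair =
  trans (sym (ρ-σ (inT n k))) (cong ρ (trans (maps-inT automorphism k) (cong (inT n) s-k))) ,
  trans (sym (ρ-σ (out n F.zero))) (cong ρ (isA1⇒out1 n _ (trans (proj₂ (swaps-out (out n F.zero))) (isA0-out0 n))))
  where
  open PairFlip (pair-flip n k)
  s-k : s k ≡ k'
  s-k = Fin.toℕ-injective (trans to-partner (sym k'-partner))
  ρ-σ : ∀ x → ρ (σ x) ≡ ρ x
  ρ-σ = invariance n ψ ρ cs σ s automorphism
          (movesOnly-preserves ψ s k (index-involutive n σ s automorphism) moves-only (trans (cong ψ s-k) (sym ψ-pair)))

block-size-1 : ∀ q t → InBlockℕ 0 q t → t ≡ q
block-size-1 q t (lo , hi) = ≤-antisym (≤-pred (subst (t <_) (cong suc (*-identityʳ q)) hi)) (subst (_≤ t) (*-identityʳ q) lo)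

block-size-2 : ∀ q t → InBlockℕ 1 q t → t ≡ q + q ⊎ t ≡ suc (q + q)
block-size-2 q t (lo , hi) with t ≟ q + q
... | yes t≡2q = inj₁ t≡2q
... | no t≢2q = inj₂ (≤-antisym (≤-pred (subst (t <_) upper hi)) (≤∧≢⇒< (subst (_≤ t) lower lo) (t≢2q ∘ sym)))
  where
  lower : q * 2 ≡ q + q
  lower = solve 1 (λ q → q :* con 2 := q :+ q) refl q
  upper : suc q * 2 ≡ suc (suc (q + q))
  upper = solve 1 (λ q → (con 1 :+ q) :* con 2 := con 1 :+ (con 1 :+ (q :+ q))) refl q

pair-cases : ∀ {N} q (i j : Fin N) → InBlock 1 q i → InBlock 1 q j → i ≡ j ⊎ toℕ j ≡ partner (toℕ i)
pair-cases q i j bi bj with block-size-2 q (toℕ i) bi | block-size-2 q (toℕ j) bj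
... | inj₁ x | inj₁ y = inj₁ (Fin.toℕ-injective (trans x (sym y)))
... | inj₂ x | inj₂ y = inj₁ (Fin.toℕ-injective (trans x (sym y)))
... | inj₁ x | inj₂ y = inj₂ (trans y (trans (sym (partner-even q)) (cong partner (sym x))))
... | inj₂ x | inj₁ y = inj₂ (trans y (trans (sym (partner-odd q)) (cong partner (sym x))))

-- Every binary block on which ψ is constant collapses under ρ: singletons trivially,
-- pairs by their pair flip, larger blocks by `collapse-block`.
collapse-binary-block : ∀ n ψ ρ → CoarsestStableRefining n ψ ρ → ∀ jj q e → jj + e ≡ suc n →
  ConstantOn ψ (InBlock e q) → ConstantOn (ρ ∘ inT n) (InBlock e q)
collapse-binary-block n ψ ρ cs jj q zero eq cst i j bi bj =
  cong (ρ ∘ inT n) (Fin.toℕ-injective (trans (block-size-1 q _ bi) (sym (block-size-1 q _ bj))))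
collapse-binary-block n ψ ρ cs jj q (suc zero) eq cst i j bi bj with pair-cases q i j bi bj
... | inj₁ refl = refl
... | inj₂ j-partner = proj₁ (pair-collapse n ψ ρ cs i j j-partner (cst i j bi bj))
collapse-binary-block zero ψ ρ cs jj q (suc (suc e)) eq cst i j bi bj =
  ⊥-elim (<⇒≱ (s≤s (s≤s z≤n)) (≤-trans (m≤n+m (suc (suc e)) jj) (≤-reflexive eq)))
collapse-binary-block (suc m) ψ ρ cs jj q (suc (suc e)) eq cst =
  collapse-block m ρ ψ (λ σ s A _ pres → invariance (suc m) ψ ρ cs σ s A pres) jj q (suc (suc e)) eq (s≤s (s≤s z≤n)) cst

agrees : ∀ n ψ ρ → BinaryBlockPartition n ψ → CoarsestStableRefining n ψ ρ → Agrees n ρ ψ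
agrees n ψ ρ blocks cs i j = mk⇔ ρ⇒ψ ψ⇒ρ
  where
  ρ⇒ψ : ρ (inT n i) ≡ ρ (inT n j) → ψ i ≡ ψ j
  ρ⇒ψ e with proj₁ (proj₂ cs) (inT n i) (inT n j) e
  ... | inj₁ (i' , j' , p , q , r) = subst₂ (λ a b → ψ a ≡ ψ b) (inT-injective n i' i p) (inT-injective n j' j q) r
  ... | inj₂ (¬B , _) = ⊥-elim (¬B (i , refl))
  ψ⇒ρ : ψ i ≡ ψ j → ρ (inT n i) ≡ ρ (inT n j)
  ψ⇒ρ e with blocks i
  ... | jj , q , jj≤ , _ , cell =
    collapse-binary-block n ψ ρ cs jj q (suc n ∸ jj) (m+[n∸m]≡n jj≤) constant i j
      (Equivalence.to (cell i) refl) (Equivalence.to (cell j) (sym e))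
    where
    constant : ConstantOn ψ (InBlock (suc n ∸ jj) q)
    constant k l bk bl = trans (Equivalence.from (cell k) bk) (sym (Equivalence.from (cell l) bl))

merge-outputs : ∀ n ψ ρ → CoarsestStableRefining n ψ ρ → ∀ p (i j : Fin (2 ^ suc n)) →
  toℕ i ≡ p + p → toℕ j ≡ suc (p + p) → ψ i ≡ ψ j → ρ (out n F.zero) ≡ ρ (out n (F.suc F.zero))
merge-outputs n ψ ρ cs p i j i-even j-odd e =
  proj₂ (pair-collapse n ψ ρ cs i j (trans j-odd (trans (sym (partner-even p)) (cong partner (sym i-even)))) e)

-- If ψ distinguishes all pairs then ψ is injective: a binary block with at least two
-- elements is a union of in-terminal pairs.

halve : ∀ t → ∃ λ p → ∃ λ b → b ≤ 1 × t ≡ p + p + b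
halve zero = 0 , 0 , z≤n , refl
halve (suc t) with halve t
... | p , zero , _ , refl = p , 1 , ≤-refl , sym (+-suc (p + p) 0)
... | p , suc zero , _ , refl = suc p , 0 , z≤n ,
      solve 1 (λ p → con 1 :+ (p :+ p :+ con 1) := con 1 :+ p :+ (con 1 :+ p) :+ con 0) refl p
... | p , suc (suc _) , s≤s () , _

double-≤ : ∀ Q p b → b ≤ 1 → Q + Q ≤ p + p + b → Q ≤ p
double-≤ Q p b b≤1 le with Q ≤? p
... | yes Q≤p = Q≤p
... | no Q≰p = ⊥-elim (<⇒≱ (begin-strict
  p + p + b       ≤⟨ +-monoʳ-≤ (p + p) b≤1 ⟩
  p + p + 1       <⟨ ≤-reflexive (cong suc (trans (+-comm (p + p) 1) (sym (+-suc p p)))) ⟩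
  suc p + suc p   ≤⟨ +-mono-≤ (≰⇒> Q≰p) (≰⇒> Q≰p) ⟩
  Q + Q           ∎) le)
  where open ≤-Reasoning

double-< : ∀ Q p b → b ≤ 1 → p < Q → p + p + b < Q + Q
double-< Q p b b≤1 p<Q = begin-strict
  p + p + b       ≤⟨ +-monoʳ-≤ (p + p) b≤1 ⟩
  p + p + 1       <⟨ ≤-reflexive (cong suc (trans (+-comm (p + p) 1) (sym (+-suc p p)))) ⟩
  suc p + suc p   ≤⟨ +-mono-≤ p<Q p<Q ⟩
  Q + Q           ∎
  where open ≤-Reasoning

block-halve : ∀ e q p b → b ≤ 1 → InBlockℕ (suc e) q (p + p + b) → InBlockℕ e q p
block-halve e q p b b≤1 (lo , hi) =
  double-≤ (q * 2 ^ e) p b b≤1 (subst (_≤ p + p + b) (twice q) lo) ,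
  ≰⇒> (λ Q'≤p → <⇒≱ (subst (p + p + b <_) (twice (suc q)) hi)
                  (≤-trans (+-mono-≤ Q'≤p Q'≤p) (m≤m+n (p + p) b)))
  where
  twice : ∀ r → r * 2 ^ suc e ≡ r * 2 ^ e + r * 2 ^ e
  twice r = solve 2 (λ r x → r :* (con 2 :* x) := r :* x :+ r :* x) refl r (2 ^ e)

block-double : ∀ e q p b → b ≤ 1 → InBlockℕ e q p → InBlockℕ (suc e) q (p + p + b)
block-double e q p b b≤1 (lo , hi) =
  subst (_≤ p + p + b) (sym (twice q)) (≤-trans (+-mono-≤ lo lo) (m≤m+n (p + p) b)) ,
  subst (p + p + b <_) (sym (twice (suc q))) (double-< (suc q * 2 ^ e) p b b≤1 hi)
  where
  twice : ∀ r → r * 2 ^ suc e ≡ r * 2 ^ e + r * 2 ^ e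
  twice r = solve 2 (λ r x → r :* (con 2 :* x) := r :* x :+ r :* x) refl r (2 ^ e)

pair-in-block : ∀ e q t → InBlockℕ (suc e) q t → ∃ λ p → InBlockℕ (suc e) q (p + p) × InBlockℕ (suc e) q (suc (p + p))
pair-in-block e q t inB with halve t
... | p , b , b≤1 , refl =
  p , subst (InBlockℕ (suc e) q) (+-identityʳ (p + p)) (block-double e q p 0 z≤n half) ,
      subst (InBlockℕ (suc e) q) (+-comm (p + p) 1) (block-double e q p 1 ≤-refl half)
  where
  half : InBlockℕ e q p
  half = block-halve e q p b b≤1 inB

block-bound : ∀ N jj e q t → jj + e ≡ N → q < 2 ^ jj → InBlockℕ e q t → t < 2 ^ N
block-bound N jj e q t eq q< (_ , hi) =
  <-≤-trans hi (≤-trans (*-monoˡ-≤ (2 ^ e) q<) (≤-reflexive (trans (sym (^-distribˡ-+-* 2 jj e)) (cong (2 ^_) eq))))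

ψ-injective : ∀ n ψ → BinaryBlockPartition n ψ → DistinguishesAllPairs n ψ → ∀ i j → ψ i ≡ ψ j → i ≡ j
ψ-injective n ψ blocks distinct i j e with blocks i
... | jj , q , jj≤ , q< , cell with suc n ∸ jj in size | Equivalence.to (cell i) refl | Equivalence.to (cell j) (sym e)
... | zero | bi | bj = Fin.toℕ-injective (trans (block-size-1 q _ bi) (sym (block-size-1 q _ bj)))
... | suc e' | bi | _ with pair-in-block e' q (toℕ i) bi
...   | p , b-even , b-odd = ⊥-elim (distinct p u v (Fin.toℕ-fromℕ< _) (Fin.toℕ-fromℕ< _) (trans (in-cell u b-even') (sym (in-cell v b-odd'))))
  where
  fits : jj + suc e' ≡ suc n
  fits = trans (cong (jj +_) (sym size)) (m+[n∸m]≡n jj≤)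
  u = F.fromℕ< (block-bound (suc n) jj (suc e') q (p + p) fits q< b-even)
  v = F.fromℕ< (block-bound (suc n) jj (suc e') q (suc (p + p)) fits q< b-odd)
  in-cell : ∀ k → InBlock (suc e') q k → ψ k ≡ ψ i
  in-cell k b = Equivalence.from (cell k) (subst (λ E → InBlock E q k) (sym size) b)
  b-even' : InBlock (suc e') q u
  b-even' = subst (InBlockℕ (suc e') q) (sym (Fin.toℕ-fromℕ< _)) b-even
  b-odd' : InBlock (suc e') q v
  b-odd' = subst (InBlockℕ (suc e') q) (sym (Fin.toℕ-fromℕ< _)) b-odd

inT-singleton : ∀ n ψ ρ → CoarsestStableRefining n ψ ρ → (∀ i j → ψ i ≡ ψ j → i ≡ j) →
  ∀ i y → ρ (inT n i) ≡ ρ y → inT n i ≡ y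
inT-singleton n ψ ρ cs injective i y e with proj₁ (proj₂ cs) (inT n i) y e
... | inj₁ (i' , j' , p , q , r) = trans (sym p) (trans (cong (inT n) (injective i' j' r)) q)
... | inj₂ (¬B , _) = ⊥-elim (¬B (i , refl))

-- Ranks: in-terminals have rank 0; inside a copy of AND₂ the c's have rank 1 and the a's
-- rank 2; the vertices of the top copy G* lie above all ranks of G' and G''.

rank₂ : V2 → ℕ
rank₂ = V2-cases _ 2 2 0 0 0 0 1 1 1 1

maxRank : ℕ → ℕ
maxRank zero = 2
maxRank (suc m) = 3 + maxRank m

rank : (m : ℕ) → V (suc m) → ℕ
rank zero x = rank₂ x
rank (suc m) (inj₁ x) = suc (maxRank m) + rank₂ x
rank (suc m) (inj₂ (inj₁ y)) = rank m y
rank (suc m) (inj₂ (inj₂ y)) = rank m y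

rank≤max : ∀ m y → rank m y ≤ maxRank m
rank≤max zero y = V2-cases (λ y → rank₂ y ≤ 2) ≤-refl ≤-refl z≤n z≤n z≤n z≤n (s≤s z≤n) (s≤s z≤n) (s≤s z≤n) (s≤s z≤n) y
rank≤max (suc m) (inj₁ x) = s≤s (≤-trans (+-monoʳ-≤ (maxRank m) (rank≤max zero x)) (≤-reflexive (+-comm (maxRank m) 2)))
rank≤max (suc m) (inj₂ (inj₁ y)) = ≤-trans (rank≤max m y) (m≤n+m (maxRank m) 3)
rank≤max (suc m) (inj₂ (inj₂ y)) = ≤-trans (rank≤max m y) (m≤n+m (maxRank m) 3)

rank-0⇒InB : ∀ m x → rank m x ≡ 0 → InB (suc m) x
rank-0⇒InB zero x = V2-cases (λ x → rank₂ x ≡ 0 → InB 1 x) (λ ()) (λ ()) (λ _ → F.zero , refl) (λ _ → F.suc F.zero , refl)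
  (λ _ → F.suc (F.suc F.zero) , refl) (λ _ → F.suc (F.suc (F.suc F.zero)) , refl) (λ ()) (λ ()) (λ ()) (λ ()) x
rank-0⇒InB (suc m) (inj₂ (inj₁ y)) r with rank-0⇒InB m y r
... | i , p = left m i , trans (inT-left m i) (cong (inj₂ ∘ inj₁) p)
rank-0⇒InB (suc m) (inj₂ (inj₂ y)) r with rank-0⇒InB m y r
... | i , p = right m i , trans (inT-right m i) (cong (inj₂ ∘ inj₂) p)

record Pinned (m : ℕ) (x : V (suc m)) (k : ℕ) : Set where
  field
    w₁ w₂ : V (suc m)
    adj-w₁ : adj (suc m) x w₁ ≡ true
    adj-w₂ : adj (suc m) x w₂ ≡ true
    rank-w₁ : rank m w₁ ≤ k
    rank-w₂ : rank m w₂ ≤ k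
    w₁-inner : isA0 (suc m) w₁ ≡ false × isA1 (suc m) w₁ ≡ false
    unique : ∀ y → adj (suc m) y w₁ ≡ true → adj (suc m) y w₂ ≡ true → rank m y ≤ k ⊎ y ≡ x

-- Inside AND₂: each c is the common neighbour of two b's, each a of two c's.  The first
-- witness is no port towards G'', the second none towards G'.
record Pinned₂ (x : V2) (k : ℕ) : Set where
  field
    v₁ v₂ : V2
    adj-v₁ : adj2 x v₁ ≡ true
    adj-v₂ : adj2 x v₂ ≡ true
    rank-v₁ : rank₂ v₁ ≤ k
    rank-v₂ : rank₂ v₂ ≤ k
    v₁-inner : isA0 1 v₁ ≡ false × isA1 1 v₁ ≡ false
    unique : ∀ y → adj2 y v₁ ≡ true → adj2 y v₂ ≡ true → y ≡ x
    v₁-not-right : ∀ n (y : V n) → crossR n y v₁ ≡ false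
    v₂-not-left : ∀ n (y : V n) → crossL n y v₂ ≡ false

common-neighbour? : (x v₁ v₂ : V2) → Dec (∀ y → adj2 y v₁ ≡ true → adj2 y v₂ ≡ true → y ≡ x)
common-neighbour? x v₁ v₂ = ∀V2? λ y → (adj2 y v₁ Bool.≟ true) →-dec (adj2 y v₂ Bool.≟ true) →-dec (y ≟₂ x)

pinned₂ : ∀ x k → rank₂ x ≡ suc k → Pinned₂ x k
pinned₂ c0 .0 refl = record { v₁ = b0 ; v₂ = b3 ; adj-v₁ = refl ; adj-v₂ = refl ; rank-v₁ = z≤n ; rank-v₂ = z≤n ; v₁-inner = refl , refl
                            ; unique = from-yes (common-neighbour? c0 b0 b3) ; v₁-not-right = λ _ _ → refl ; v₂-not-left = λ _ _ → refl }
pinned₂ c1 .0 refl = record { v₁ = b1 ; v₂ = b2 ; adj-v₁ = refl ; adj-v₂ = refl ; rank-v₁ = z≤n ; rank-v₂ = z≤n ; v₁-inner = refl , refl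
                            ; unique = from-yes (common-neighbour? c1 b1 b2) ; v₁-not-right = λ _ _ → refl ; v₂-not-left = λ _ _ → refl }
pinned₂ c2 .0 refl = record { v₁ = b0 ; v₂ = b2 ; adj-v₁ = refl ; adj-v₂ = refl ; rank-v₁ = z≤n ; rank-v₂ = z≤n ; v₁-inner = refl , refl
                            ; unique = from-yes (common-neighbour? c2 b0 b2) ; v₁-not-right = λ _ _ → refl ; v₂-not-left = λ _ _ → refl }
pinned₂ c3 .0 refl = record { v₁ = b1 ; v₂ = b3 ; adj-v₁ = refl ; adj-v₂ = refl ; rank-v₁ = z≤n ; rank-v₂ = z≤n ; v₁-inner = refl , refl
                            ; unique = from-yes (common-neighbour? c3 b1 b3) ; v₁-not-right = λ _ _ → refl ; v₂-not-left = λ _ _ → refl }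
pinned₂ a0 .1 refl = record { v₁ = c0 ; v₂ = c1 ; adj-v₁ = refl ; adj-v₂ = refl ; rank-v₁ = ≤-refl ; rank-v₂ = ≤-refl ; v₁-inner = refl , refl
                            ; unique = from-yes (common-neighbour? a0 c0 c1) ; v₁-not-right = λ _ _ → refl ; v₂-not-left = λ _ _ → refl }
pinned₂ a1 .1 refl = record { v₁ = c2 ; v₂ = c3 ; adj-v₁ = refl ; adj-v₂ = refl ; rank-v₁ = ≤-refl ; rank-v₂ = ≤-refl ; v₁-inner = refl , refl
                            ; unique = from-yes (common-neighbour? a1 c2 c3) ; v₁-not-right = λ _ _ → refl ; v₂-not-left = λ _ _ → refl }

false≢true : false ≡ true → ⊥
false≢true ()

crossL-inner : ∀ n (w : V n) → isA0 n w ≡ false × isA1 n w ≡ false → ∀ y → crossL n w y ≡ false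
crossL-inner n w (p , q) = V2-cases _ refl refl p q refl refl refl refl refl refl

crossR-inner : ∀ n (w : V n) → isA0 n w ≡ false × isA1 n w ≡ false → ∀ y → crossR n w y ≡ false
crossR-inner n w (p , q) = V2-cases _ refl refl refl refl p q refl refl refl refl

pinned-top : ∀ m x k → Pinned₂ x k → Pinned (suc m) (inj₁ x) (maxRank m + suc k)
pinned-top m x k P = record
  { w₁ = inj₁ v₁ ; w₂ = inj₁ v₂ ; adj-w₁ = adj-v₁ ; adj-w₂ = adj-v₂
  ; rank-w₁ = lifted rank-v₁ ; rank-w₂ = lifted rank-v₂
  ; w₁-inner = trans (isA0-G* m v₁) (proj₁ v₁-inner) , trans (isA1-G* m v₁) (proj₂ v₁-inner)
  ; unique = unique' }
  where
  open Pinned₂ P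
  lifted : ∀ {r} → r ≤ k → suc (maxRank m) + r ≤ maxRank m + suc k
  lifted {r} r≤k = ≤-trans (+-monoʳ-≤ (suc (maxRank m)) r≤k) (≤-reflexive (sym (+-suc (maxRank m) k)))
  unique' : ∀ y → adj (suc (suc m)) y (inj₁ v₁) ≡ true → adj (suc (suc m)) y (inj₁ v₂) ≡ true →
    rank (suc m) y ≤ maxRank m + suc k ⊎ y ≡ inj₁ x
  unique' (inj₁ y) p q = inj₂ (cong inj₁ (unique y p q))
  unique' (inj₂ (inj₁ y)) p q = ⊥-elim (false≢true (trans (sym (v₂-not-left (suc m) y)) q))
  unique' (inj₂ (inj₂ y)) p q = ⊥-elim (false≢true (trans (sym (v₁-not-right (suc m) y)) p))

below-top : ∀ m y → rank m y ≤ maxRank m + 0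
below-top m y = ≤-trans (rank≤max m y) (m≤m+n (maxRank m) 0)

-- a vertex pinned in G' (resp. G'') stays pinned in AND_ℓ, since its first witness has
-- no neighbours outside G'
pinned-left : ∀ m x k → Pinned m x k → Pinned (suc m) (inj₂ (inj₁ x)) k
pinned-left m x k P = record
  { w₁ = inj₂ (inj₁ w₁) ; w₂ = inj₂ (inj₁ w₂) ; adj-w₁ = adj-w₁ ; adj-w₂ = adj-w₂ ; rank-w₁ = rank-w₁ ; rank-w₂ = rank-w₂
  ; w₁-inner = refl , refl ; unique = unique' }
  where
  open Pinned P
  unique' : ∀ y → adj (suc (suc m)) y (inj₂ (inj₁ w₁)) ≡ true → adj (suc (suc m)) y (inj₂ (inj₁ w₂)) ≡ true →
    rank (suc m) y ≤ k ⊎ y ≡ inj₂ (inj₁ x)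
  unique' (inj₁ y) p q = ⊥-elim (false≢true (trans (sym (crossL-inner (suc m) w₁ w₁-inner y)) p))
  unique' (inj₂ (inj₁ y)) p q = Sum.map₂ (cong (inj₂ ∘ inj₁)) (unique y p q)
  unique' (inj₂ (inj₂ y)) () q

pinned-right : ∀ m x k → Pinned m x k → Pinned (suc m) (inj₂ (inj₂ x)) k
pinned-right m x k P = record
  { w₁ = inj₂ (inj₂ w₁) ; w₂ = inj₂ (inj₂ w₂) ; adj-w₁ = adj-w₁ ; adj-w₂ = adj-w₂ ; rank-w₁ = rank-w₁ ; rank-w₂ = rank-w₂
  ; w₁-inner = refl , refl ; unique = unique' }
  where
  open Pinned P
  unique' : ∀ y → adj (suc (suc m)) y (inj₂ (inj₂ w₁)) ≡ true → adj (suc (suc m)) y (inj₂ (inj₂ w₂)) ≡ true →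
    rank (suc m) y ≤ k ⊎ y ≡ inj₂ (inj₂ x)
  unique' (inj₁ y) p q = ⊥-elim (false≢true (trans (sym (crossR-inner (suc m) w₁ w₁-inner y)) p))
  unique' (inj₂ (inj₂ y)) p q = Sum.map₂ (cong (inj₂ ∘ inj₂)) (unique y p q)
  unique' (inj₂ (inj₁ y)) () q

pinned-via-left : ∀ m x (w : V (suc m)) → crossL (suc m) w x ≡ true → (∀ y → crossL (suc m) w y ≡ true → y ≡ x) →
  Pinned (suc m) (inj₁ x) (maxRank m + 0)
pinned-via-left m x w a only = record
  { w₁ = inj₂ (inj₁ w) ; w₂ = inj₂ (inj₁ w) ; adj-w₁ = a ; adj-w₂ = a
  ; rank-w₁ = below-top m w ; rank-w₂ = below-top m w ; w₁-inner = refl , refl ; unique = unique' }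
  where
  unique' : ∀ y → adj (suc (suc m)) y (inj₂ (inj₁ w)) ≡ true → adj (suc (suc m)) y (inj₂ (inj₁ w)) ≡ true →
    rank (suc m) y ≤ maxRank m + 0 ⊎ y ≡ inj₁ x
  unique' (inj₁ y) p _ = inj₂ (cong inj₁ (only y p))
  unique' (inj₂ (inj₁ y)) _ _ = inj₁ (below-top m y)
  unique' (inj₂ (inj₂ y)) () _

pinned-via-right : ∀ m x (w : V (suc m)) → crossR (suc m) w x ≡ true → (∀ y → crossR (suc m) w y ≡ true → y ≡ x) →
  Pinned (suc m) (inj₁ x) (maxRank m + 0)
pinned-via-right m x w a only = record
  { w₁ = inj₂ (inj₂ w) ; w₂ = inj₂ (inj₂ w) ; adj-w₁ = a ; adj-w₂ = a
  ; rank-w₁ = below-top m w ; rank-w₂ = below-top m w ; w₁-inner = refl , refl ; unique = unique' }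
  where
  unique' : ∀ y → adj (suc (suc m)) y (inj₂ (inj₂ w)) ≡ true → adj (suc (suc m)) y (inj₂ (inj₂ w)) ≡ true →
    rank (suc m) y ≤ maxRank m + 0 ⊎ y ≡ inj₁ x
  unique' (inj₁ y) p _ = inj₂ (cong inj₁ (only y p))
  unique' (inj₂ (inj₂ y)) _ _ = inj₁ (below-top m y)
  unique' (inj₂ (inj₁ y)) () _

isA1-out0 : ∀ n → isA1 n (out n F.zero) ≡ false
isA1-out0 zero = refl
isA1-out0 (suc zero) = refl
isA1-out0 (suc (suc n)) = refl

isA0-out1 : ∀ n → isA0 n (out n (F.suc F.zero)) ≡ false
isA0-out1 zero = refl
isA0-out1 (suc zero) = refl
isA0-out1 (suc (suc n)) = refl

isA1-out1 : ∀ n → isA1 n (out n (F.suc F.zero)) ≡ true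
isA1-out1 zero = refl
isA1-out1 (suc zero) = refl
isA1-out1 (suc (suc n)) = refl

crossL-a0 : ∀ n y → crossL n (out n F.zero) y ≡ true → y ≡ b0
crossL-a0 n = V2-cases _ (λ ()) (λ ()) (λ _ → refl) (λ e → ⊥-elim (false≢true (trans (sym (isA1-out0 n)) e))) (λ ()) (λ ()) (λ ()) (λ ()) (λ ()) (λ ())

crossL-a1 : ∀ n y → crossL n (out n (F.suc F.zero)) y ≡ true → y ≡ b1
crossL-a1 n = V2-cases _ (λ ()) (λ ()) (λ e → ⊥-elim (false≢true (trans (sym (isA0-out1 n)) e))) (λ _ → refl) (λ ()) (λ ()) (λ ()) (λ ()) (λ ()) (λ ())

crossR-a0 : ∀ n y → crossR n (out n F.zero) y ≡ true → y ≡ b2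
crossR-a0 n = V2-cases _ (λ ()) (λ ()) (λ ()) (λ ()) (λ _ → refl) (λ e → ⊥-elim (false≢true (trans (sym (isA1-out0 n)) e))) (λ ()) (λ ()) (λ ()) (λ ())

crossR-a1 : ∀ n y → crossR n (out n (F.suc F.zero)) y ≡ true → y ≡ b3
crossR-a1 n = V2-cases _ (λ ()) (λ ()) (λ ()) (λ ()) (λ e → ⊥-elim (false≢true (trans (sym (isA0-out1 n)) e))) (λ _ → refl) (λ ()) (λ ()) (λ ()) (λ ())

pinned : ∀ m x k → rank m x ≡ suc k → Pinned m x k
pinned zero x k r = record
  { w₁ = v₁ ; w₂ = v₂ ; adj-w₁ = adj-v₁ ; adj-w₂ = adj-v₂ ; rank-w₁ = rank-v₁ ; rank-w₂ = rank-v₂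
  ; w₁-inner = v₁-inner ; unique = λ y p q → inj₂ (unique y p q) }
  where open Pinned₂ (pinned₂ x k r)
pinned (suc m) (inj₁ c0) .(maxRank m + 1) refl = pinned-top m c0 0 (pinned₂ c0 0 refl)
pinned (suc m) (inj₁ c1) .(maxRank m + 1) refl = pinned-top m c1 0 (pinned₂ c1 0 refl)
pinned (suc m) (inj₁ c2) .(maxRank m + 1) refl = pinned-top m c2 0 (pinned₂ c2 0 refl)
pinned (suc m) (inj₁ c3) .(maxRank m + 1) refl = pinned-top m c3 0 (pinned₂ c3 0 refl)
pinned (suc m) (inj₁ a0) .(maxRank m + 2) refl = pinned-top m a0 1 (pinned₂ a0 1 refl)
pinned (suc m) (inj₁ a1) .(maxRank m + 2) refl = pinned-top m a1 1 (pinned₂ a1 1 refl)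
pinned (suc m) (inj₁ b0) .(maxRank m + 0) refl = pinned-via-left m b0 (out (suc m) F.zero) (isA0-out0 (suc m)) (crossL-a0 (suc m))
pinned (suc m) (inj₁ b1) .(maxRank m + 0) refl = pinned-via-left m b1 (out (suc m) (F.suc F.zero)) (isA1-out1 (suc m)) (crossL-a1 (suc m))
pinned (suc m) (inj₁ b2) .(maxRank m + 0) refl = pinned-via-right m b2 (out (suc m) F.zero) (isA0-out0 (suc m)) (crossR-a0 (suc m))
pinned (suc m) (inj₁ b3) .(maxRank m + 0) refl = pinned-via-right m b3 (out (suc m) (F.suc F.zero)) (isA1-out1 (suc m)) (crossR-a1 (suc m))
pinned (suc m) (inj₂ (inj₁ y)) k r = pinned-left m y k (pinned m y k r)
pinned (suc m) (inj₂ (inj₂ y)) k r = pinned-right m y k (pinned m y k r)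

-- A vertex y coloured like a pinned x has neighbours coloured
-- like the witnesses, hence (by induction) adjacent to the witnesses themselves, so y = x.
all-singletons : ∀ m ρ → Stable (suc m) ρ → (∀ x → rank m x ≡ 0 → ∀ y → ρ x ≡ ρ y → x ≡ y) →
  ∀ k x → rank m x ≤ k → ∀ y → ρ x ≡ ρ y → x ≡ y
all-singletons m ρ st base zero x r y e = base x (n≤0⇒n≡0 r) y e
all-singletons m ρ st base (suc k) x r y e with m≤n⇒m<n∨m≡n r
... | inj₁ r< = all-singletons m ρ st base k x (≤-pred r<) y e
... | inj₂ r≡ = conclude (unique y (adjacent-to w₁ adj-w₁ rank-w₁) (adjacent-to w₂ adj-w₂ rank-w₂))
  where
  open Pinned (pinned m x k r≡)
  adjacent-to : ∀ w → adj (suc m) x w ≡ true → rank m w ≤ k → adj (suc m) y w ≡ true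
  adjacent-to w a rw with stable-neighbour (suc m) ρ st x y w e a
  ... | w' , a' , same = subst (λ z → adj (suc m) y z ≡ true) (sym (all-singletons m ρ st base k w rw w' (sym same))) a'
  conclude : rank m y ≤ k ⊎ y ≡ x → x ≡ y
  conclude (inj₁ ry) = sym (all-singletons m ρ st base k y ry x (sym e))
  conclude (inj₂ y≡x) = sym y≡x

-- Second claim, second half: if ψ distinguishes all pairs then ρ separates a₀ from a₁,
-- because ψ is then injective and ρ discrete.
separate-outputs : ∀ n ψ ρ → BinaryBlockPartition n ψ → CoarsestStableRefining n ψ ρ → DistinguishesAllPairs n ψ →
  ρ (out n F.zero) ≢ ρ (out n (F.suc F.zero))
separate-outputs zero ψ ρ blocks cs distinct e with stable-neighbour 0 ρ (proj₁ cs) a0 a1 b0 e refl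
... | b1 , _ , same = case (inT-singleton 0 ψ ρ cs (ψ-injective 0 ψ blocks distinct) F.zero b1 (sym same))
  where
  case : ¬ b0 ≡ b1
  case ()
... | a0 , () , _
... | a1 , () , _
... | b0 , () , _
separate-outputs (suc m) ψ ρ blocks cs distinct e =
  distinct-outs m (all-singletons m ρ (proj₁ cs) rank-0-singleton _ _ ≤-refl _ e)
  where
  distinct-outs : ∀ m → ¬ out (suc m) F.zero ≡ out (suc m) (F.suc F.zero)
  distinct-outs zero ()
  distinct-outs (suc m) ()
  rank-0-singleton : ∀ x → rank m x ≡ 0 → ∀ y → ρ x ≡ ρ y → x ≡ y
  rank-0-singleton x r with rank-0⇒InB m x r
  ... | i , refl = inT-singleton (suc m) ψ ρ cs (ψ-injective (suc m) ψ blocks distinct) i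

lemma5 : (n : ℕ) (ψ : Fin (2 ^ suc n) → ℕ) (ρ : V n → ℕ) →
    BinaryBlockPartition n ψ →
    CoarsestStableRefining n ψ ρ →
    Agrees n ρ ψ ×
      ((ρ (out n F.zero) ≢ ρ (out n (F.suc F.zero))) ⇔ DistinguishesAllPairs n ψ)
lemma5 n ψ ρ blocks cs =
  agrees n ψ ρ blocks cs ,
  mk⇔ (λ separated p i j i-even j-odd same → separated (merge-outputs n ψ ρ cs p i j i-even j-odd same))
      (separate-outputs n ψ ρ blocks cs)
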